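{- Let $a,b,c,f\ge1$ be integers such that $b>12\ln(4a)$, and let $\gamma$ be a real number with $(3a\ln(4af)/c)^{1/2}<\gamma<1$. Let $U$ be a set with $|U|=a\cdot b$ and let $\mathcal{F}\subseteq 2^U$ be a family of $|\mathcal{F}|=f$ subsets of $U$, each of size at least $c$. Then there is a partition $U=\bigcup_{i=1}^a U_i$ such that (1) $b/2\le|U_i|\le 3b/2$ for all $1\le i\le a$, and (2) for every $F\in\mathcal{F}$ and every $1\le i\le a$, $(1-\gamma)|F|/a\le|F\cap U_i|\le(1+\gamma)|F|/a$.
   Formalization: The parameter γ ranges over the rationals rather than the reals. -}

module Defs where

open import Data.Nat using (ℕ; zero; suc)
open import Data.Integer using (+_)
open import Data.Rational using (ℚ; _+_; _*_; _/_; _<_; 1ℚ)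
open import Data.Fin using (Fin; _≟_)
open import Data.Fin.Subset using (Subset; inside; outside)
open import Data.Vec using (tabulate)
open import Relation.Nullary using (yes; no)
open import Data.Product using (∃)

ℕ→ℚ : ℕ → ℚ
ℕ→ℚ n = + n / 1

expTerm : ℚ → ℕ → ℚ
expTerm x zero    = 1ℚ
expTerm x (suc k) = expTerm x k * (x * (+ 1 / suc k))

expPartial : ℚ → ℕ → ℚ
expPartial x zero    = + 0 / 1
expPartial x (suc n) = expPartial x n + expTerm x n

-- y < e^x  (e^x is the limit of the increasing partial sums, for x ≥ 0;
-- a strict lower bound is exceeded by some partial sum)
_<exp_ : ℚ → ℚ → Set
y <exp x = ∃ λ n → y < expPartial x n

-- LnLt y x :  ln y < x, for y > 0, i.e. y < e^x
LnLt : ℚ → ℚ → Set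
LnLt y x = y <exp x

block : ∀ {n a} → (Fin n → Fin a) → Fin a → Subset n
block p i = tabulate λ u → dec (p u ≟ i)
  where
  dec : ∀ {P : Set} → Relation.Nullary.Dec P → _
  dec (yes _) = inside
  dec (no _)  = outside

{-# OPTIONS --safe #-}
module Submission where

-- Let every point of U choose its part independently and uniformly at random; the probability space
-- is finite, so probabilities are averages over all maps U → Fin a.  For S ⊆ U and a part i, the
-- variable X = |S ∩ U_i| satisfies E[t ^ X] = (1 + (t - 1) / a) ^ |S|.  Markov's inequality for t ^ X,
-- with t = 1 + v and t = 1 - u where v = γ - γ²/4 and u = γ - γ²/2, bounds the probabilities that
-- a X > (1 + γ)|S| and that a X < (1 - γ)|S| by e ^ (- γ² |S| / 3a) each.  As e ^ x is only given
-- through its partial sums, the estimate uses the approximate multiplicativity of the partial sums,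
-- a geometric bound on their tails, and polynomial inequalities in γ certified in Bernstein form;
-- the rational exponent (1 ± γ)|S| / a, with γ = P / Q, is handled by comparing (a Q)-th powers.
-- By the hypotheses ln (4a) < b / 12 and ln (4af) < c γ² / 3a, the 2a bad events for the part sizes
-- (the case S = U, γ = 1/2) and the 2af bad events for the family have total probability below 1,
-- so some map avoids all of them.

open import Defs

module RandomPartition where

  open import Data.Nat as ℕ using (ℕ; zero; suc; z≤n; s≤s)
  import Data.Nat.Properties as ℕ
  import Data.Nat.DivMod as ℕ
  open import Data.Nat.Coprimality using (Coprime; 1-coprimeTo)
  import Data.Integer as ℤ
  import Data.Integer.Properties as ℤ
  open import Data.Rational hiding (∣_∣)
  open import Data.Rational.Properties
  import Data.Rational.Unnormalised as ℚᵘ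
  import Data.Rational.Unnormalised.Properties as ℚᵘ
  open import Data.Rational.Solver
  open import Algebra.Bundles using (CommutativeRing)
  open import Algebra.Properties.CommutativeSemiring.Exp (CommutativeRing.commutativeSemiring +-*-commutativeRing)
  open import Algebra.Properties.Semiring.Sum (CommutativeRing.semiring +-*-commutativeRing)
    using (sum; sum-syntax; sum-cong-≗; ∑-distrib-+; *-distribˡ-sum; *-distribʳ-sum)
  open import Data.Fin using (Fin; zero; suc)
  import Data.Fin as Fin
  open import Data.Fin.Subset using (Subset; ⊤; ∣_∣; _∩_)
  open import Data.Fin.Subset.Properties using (∣⊤∣≡n; ∩-identityˡ)
  open import Data.Vec using ([]; _∷_)
  open import Data.Vec.Functional using () renaming (_∷_ to _◃_)
  open import Data.List using (List; []; _∷_)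
  open import Data.Bool using (true; false; if_then_else_)
  open import Data.Product using (Σ; _×_; _,_; proj₁; proj₂; uncurry)
  open import Data.Sum using (inj₁; inj₂)
  open import Data.Empty using (⊥-elim)
  open import Relation.Nullary using (¬_; yes; no; does)
  open import Relation.Nullary.Decidable using (from-yes)
  open import Relation.Binary.PropositionalEquality
  open +-*-Solver

  -- Ordered field facts, naturals and powers in ℚ

  0≤1 : 0ℚ ≤ 1ℚ
  0≤1 = nonNegative⁻¹ 1ℚ

  0<1 : 0ℚ < 1ℚ
  0<1 = positive⁻¹ 1ℚ

  -- Monotonicity of multiplication with the sign condition as an ordinary hypothesis; ˡ means
  -- that the fixed factor is on the left (for _<_ the library's ˡ and ʳ are the other way round).
  *-monoˡ-≤-0≤ : ∀ {r p q} → 0ℚ ≤ r → p ≤ q → r * p ≤ r * q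
  *-monoˡ-≤-0≤ {r} 0≤r = *-monoˡ-≤-nonNeg r {{nonNegative 0≤r}}

  *-monoʳ-≤-0≤ : ∀ {r p q} → 0ℚ ≤ r → p ≤ q → p * r ≤ q * r
  *-monoʳ-≤-0≤ {r} 0≤r = *-monoʳ-≤-nonNeg r {{nonNegative 0≤r}}

  *-mono-≤-0≤ : ∀ {p q r s} → 0ℚ ≤ p → 0ℚ ≤ r → p ≤ q → r ≤ s → p * r ≤ q * s
  *-mono-≤-0≤ 0≤p 0≤r p≤q r≤s = ≤-trans (*-monoʳ-≤-0≤ 0≤r p≤q) (*-monoˡ-≤-0≤ (≤-trans 0≤p p≤q) r≤s)

  *-monoˡ-<-0< : ∀ {r p q} → 0ℚ < r → p < q → r * p < r * q
  *-monoˡ-<-0< {r} 0<r = *-monoʳ-<-pos r {{positive 0<r}}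

  *-monoʳ-<-0< : ∀ {r p q} → 0ℚ < r → p < q → p * r < q * r
  *-monoʳ-<-0< {r} 0<r = *-monoˡ-<-pos r {{positive 0<r}}

  *-cancelˡ-≤-0< : ∀ {r p q} → 0ℚ < r → r * p ≤ r * q → p ≤ q
  *-cancelˡ-≤-0< {r} 0<r = *-cancelˡ-≤-pos r {{positive 0<r}}

  *-cancelˡ-<-0≤ : ∀ {r p q} → 0ℚ ≤ r → r * p < r * q → p < q
  *-cancelˡ-<-0≤ {r} 0≤r = *-cancelˡ-<-nonNeg r {{nonNegative 0≤r}}

  0≤p*q : ∀ {p q} → 0ℚ ≤ p → 0ℚ ≤ q → 0ℚ ≤ p * q
  0≤p*q {p} {q} 0≤p 0≤q = subst (_≤ p * q) (*-zeroʳ p) (*-monoˡ-≤-0≤ 0≤p 0≤q)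

  0<p*q : ∀ {p q} → 0ℚ < p → 0ℚ < q → 0ℚ < p * q
  0<p*q {p} {q} 0<p 0<q = positive⁻¹ (p * q) {{pos*pos⇒pos p {{positive 0<p}} q {{positive 0<q}}}}

  0≤p+q : ∀ {p q} → 0ℚ ≤ p → 0ℚ ≤ q → 0ℚ ≤ p + q
  0≤p+q = +-mono-≤

  0≤p*p : ∀ p → 0ℚ ≤ p * p
  0≤p*p p with ≤-total 0ℚ p
  ... | inj₁ 0≤p = 0≤p*q 0≤p 0≤p
  ... | inj₂ p≤0 = subst (0ℚ ≤_) (solve 1 (λ p → (:- p) :* (:- p) := p :* p) refl p)
                     (0≤p*q (neg-antimono-≤ p≤0) (neg-antimono-≤ p≤0))

  p≤p+q : ∀ {p q} → 0ℚ ≤ q → p ≤ p + q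
  p≤p+q {p} {q} 0≤q = subst (_≤ p + q) (+-identityʳ p) (+-monoʳ-≤ p 0≤q)

  p≤q+p : ∀ {p q} → 0ℚ ≤ q → p ≤ q + p
  p≤q+p {p} {q} 0≤q = subst (_≤ q + p) (+-identityˡ p) (+-monoˡ-≤ p 0≤q)

  p-q≤p : ∀ {p q} → 0ℚ ≤ q → p - q ≤ p
  p-q≤p {p} {q} 0≤q = subst (p - q ≤_) (solve 2 (λ p q → (p :- q) :+ q := p) refl p q) (p≤p+q 0≤q)

  p≤q⇒0≤q-p : ∀ {p q} → p ≤ q → 0ℚ ≤ q - p
  p≤q⇒0≤q-p {p} {q} p≤q = subst (_≤ q - p) (+-inverseʳ p) (+-monoˡ-≤ (- p) p≤q)

  0≤q-p⇒p≤q : ∀ {p q} → 0ℚ ≤ q - p → p ≤ q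
  0≤q-p⇒p≤q {p} {q} 0≤q-p = subst₂ _≤_ (+-identityˡ p) (solve 2 (λ p q → (q :- p) :+ p := q) refl p q)
                              (+-monoˡ-≤ p 0≤q-p)

  ℕ→ℚ≡mkℚ : ∀ n → ℕ→ℚ n ≡ mkℚ (ℤ.+ n) 0 (Data.Nat.Coprimality.sym (1-coprimeTo n))
  ℕ→ℚ≡mkℚ n = normalize-coprime (Data.Nat.Coprimality.sym (1-coprimeTo n))

  ℕ→ℚ-suc : ∀ n → ℕ→ℚ (suc n) ≡ 1ℚ + ℕ→ℚ n
  ℕ→ℚ-suc n rewrite ℕ→ℚ≡mkℚ n | ℤ.*-identityʳ (ℤ.+ n) = refl

  ℕ→ℚ-homo-+ : ∀ m n → ℕ→ℚ (m ℕ.+ n) ≡ ℕ→ℚ m + ℕ→ℚ n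
  ℕ→ℚ-homo-+ zero    n = sym (+-identityˡ (ℕ→ℚ n))
  ℕ→ℚ-homo-+ (suc m) n = begin
    ℕ→ℚ (suc (m ℕ.+ n))      ≡⟨ ℕ→ℚ-suc (m ℕ.+ n) ⟩
    1ℚ + ℕ→ℚ (m ℕ.+ n)       ≡⟨ cong (1ℚ +_) (ℕ→ℚ-homo-+ m n) ⟩
    1ℚ + (ℕ→ℚ m + ℕ→ℚ n)     ≡⟨ sym (+-assoc 1ℚ (ℕ→ℚ m) (ℕ→ℚ n)) ⟩
    (1ℚ + ℕ→ℚ m) + ℕ→ℚ n     ≡⟨ cong (_+ ℕ→ℚ n) (sym (ℕ→ℚ-suc m)) ⟩
    ℕ→ℚ (suc m) + ℕ→ℚ n      ∎
    where open ≡-Reasoning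

  ℕ→ℚ-homo-* : ∀ m n → ℕ→ℚ (m ℕ.* n) ≡ ℕ→ℚ m * ℕ→ℚ n
  ℕ→ℚ-homo-* zero    n = sym (*-zeroˡ (ℕ→ℚ n))
  ℕ→ℚ-homo-* (suc m) n = begin
    ℕ→ℚ (n ℕ.+ m ℕ.* n)          ≡⟨ ℕ→ℚ-homo-+ n (m ℕ.* n) ⟩
    ℕ→ℚ n + ℕ→ℚ (m ℕ.* n)        ≡⟨ cong (ℕ→ℚ n +_) (ℕ→ℚ-homo-* m n) ⟩
    ℕ→ℚ n + ℕ→ℚ m * ℕ→ℚ n        ≡⟨ solve 2 (λ m n → n :+ m :* n := (con 1ℚ :+ m) :* n) refl (ℕ→ℚ m) (ℕ→ℚ n) ⟩
    (1ℚ + ℕ→ℚ m) * ℕ→ℚ n         ≡⟨ cong (_* ℕ→ℚ n) (sym (ℕ→ℚ-suc m)) ⟩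
    ℕ→ℚ (suc m) * ℕ→ℚ n          ∎
    where open ≡-Reasoning

  ℕ→ℚ-suc-* : ∀ k u → ℕ→ℚ (suc k) * u ≡ u + ℕ→ℚ k * u
  ℕ→ℚ-suc-* k u = trans (cong (_* u) (ℕ→ℚ-suc k)) (solve 2 (λ k u → (con 1ℚ :+ k) :* u := u :+ k :* u) refl (ℕ→ℚ k) u)

  ℕ→ℚ-homo-∸ : ∀ {m n} → n ℕ.≤ m → ℕ→ℚ (m ℕ.∸ n) ≡ ℕ→ℚ m - ℕ→ℚ n
  ℕ→ℚ-homo-∸ {m} {n} n≤m = begin
    ℕ→ℚ (m ℕ.∸ n)                      ≡⟨ solve 2 (λ d n → d := (n :+ d) :- n) refl (ℕ→ℚ (m ℕ.∸ n)) (ℕ→ℚ n) ⟩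
    (ℕ→ℚ n + ℕ→ℚ (m ℕ.∸ n)) - ℕ→ℚ n    ≡⟨ cong (_- ℕ→ℚ n) (sym (ℕ→ℚ-homo-+ n (m ℕ.∸ n))) ⟩
    ℕ→ℚ (n ℕ.+ (m ℕ.∸ n)) - ℕ→ℚ n      ≡⟨ cong (λ k → ℕ→ℚ k - ℕ→ℚ n) (ℕ.m+[n∸m]≡n n≤m) ⟩
    ℕ→ℚ m - ℕ→ℚ n                      ∎
    where open ≡-Reasoning

  ℕ→ℚ-nonNeg : ∀ n → 0ℚ ≤ ℕ→ℚ n
  ℕ→ℚ-nonNeg n rewrite ℕ→ℚ≡mkℚ n = nonNegative⁻¹ _

  ℕ→ℚ-mono-≤ : ∀ {m n} → m ℕ.≤ n → ℕ→ℚ m ≤ ℕ→ℚ n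
  ℕ→ℚ-mono-≤ {m} {n} m≤n = begin
    ℕ→ℚ m                    ≤⟨ p≤p+q (ℕ→ℚ-nonNeg (n ℕ.∸ m)) ⟩
    ℕ→ℚ m + ℕ→ℚ (n ℕ.∸ m)    ≡⟨ sym (ℕ→ℚ-homo-+ m (n ℕ.∸ m)) ⟩
    ℕ→ℚ (m ℕ.+ (n ℕ.∸ m))    ≡⟨ cong ℕ→ℚ (ℕ.m+[n∸m]≡n m≤n) ⟩
    ℕ→ℚ n                    ∎
    where open ≤-Reasoning

  ℕ→ℚ-mono-< : ∀ {m n} → m ℕ.< n → ℕ→ℚ m < ℕ→ℚ n
  ℕ→ℚ-mono-< {m} {suc n} (s≤s m≤n) = <-≤-trans m<1+m (ℕ→ℚ-mono-≤ (s≤s m≤n))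
    where
    m<1+m : ℕ→ℚ m < ℕ→ℚ (suc m)
    m<1+m = subst₂ _<_ (+-identityˡ (ℕ→ℚ m)) (sym (ℕ→ℚ-suc m)) (+-monoˡ-< (ℕ→ℚ m) 0<1)

  ℕ→ℚ-pos : ∀ n → 0ℚ < ℕ→ℚ (suc n)
  ℕ→ℚ-pos n = ℕ→ℚ-mono-< {0} {suc n} (s≤s z≤n)

  ℕ→ℚ-cancel-≤ : ∀ {m n} → ℕ→ℚ m ≤ ℕ→ℚ n → m ℕ.≤ n
  ℕ→ℚ-cancel-≤ {m} {n} h with m ℕ.≤? n
  ... | yes m≤n = m≤n
  ... | no m≰n = ⊥-elim (<-irrefl refl (<-≤-trans (ℕ→ℚ-mono-< (ℕ.≰⇒> m≰n)) h))

  1/suc : ℕ → ℚ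
  1/suc k = ℤ.+ 1 / suc k

  1/suc-nonNeg : ∀ k → 0ℚ ≤ 1/suc k
  1/suc-nonNeg k rewrite normalize-coprime {1} {k} (1-coprimeTo (suc k)) = nonNegative⁻¹ _

  ℕ→ℚ*1/suc : ∀ k → ℕ→ℚ (suc k) * 1/suc k ≡ 1ℚ
  ℕ→ℚ*1/suc k rewrite ℕ→ℚ≡mkℚ (suc k) | normalize-coprime {1} {k} (1-coprimeTo (suc k)) =
    *-inverseʳ (mkℚ (ℤ.+ suc k) 0 (Data.Nat.Coprimality.sym (1-coprimeTo (suc k))))

  1/suc≤1 : ∀ k → 1/suc k ≤ 1ℚ
  1/suc≤1 k = begin
    1/suc k                    ≡⟨ sym (*-identityˡ (1/suc k)) ⟩
    1ℚ * 1/suc k               ≤⟨ *-monoʳ-≤-0≤ (1/suc-nonNeg k) (ℕ→ℚ-mono-≤ {1} {suc k} (s≤s z≤n)) ⟩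
    ℕ→ℚ (suc k) * 1/suc k      ≡⟨ ℕ→ℚ*1/suc k ⟩
    1ℚ                         ∎
    where open ≤-Reasoning

  +n/[1+d]≡n*1/suc : ∀ n d → ℤ.+ n / suc d ≡ ℕ→ℚ n * 1/suc d
  +n/[1+d]≡n*1/suc n d = toℚᵘ-injective (ℚᵘ.≃-trans (toℚᵘ-fromℚᵘ (ℚᵘ.mkℚᵘ (ℤ.+ n) d))
                                          (ℚᵘ.≃-trans unnormalised (ℚᵘ.≃-sym (toℚᵘ-homo-* (ℕ→ℚ n) (1/suc d)))))
    where
    unnormalised : ℚᵘ.mkℚᵘ (ℤ.+ n) d ℚᵘ.≃ toℚᵘ (ℕ→ℚ n) ℚᵘ.* toℚᵘ (1/suc d)
    unnormalised rewrite ℕ→ℚ≡mkℚ n | normalize-coprime {1} {d} (1-coprimeTo (suc d)) =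
      ℚᵘ.*≡* (sym (ℤ.*-assoc (ℤ.+ n) (ℤ.+ 1) (ℤ.+ suc d)))

  [1+d]*mkℚ≡n : ∀ n d .(c : Coprime n (suc d)) → ℕ→ℚ (suc d) * mkℚ (ℤ.+ n) d c ≡ ℕ→ℚ n
  [1+d]*mkℚ≡n n d c = begin
    ℕ→ℚ (suc d) * mkℚ (ℤ.+ n) d c        ≡⟨ cong (ℕ→ℚ (suc d) *_) (sym (normalize-coprime c)) ⟩
    ℕ→ℚ (suc d) * (ℤ.+ n / suc d)        ≡⟨ cong (ℕ→ℚ (suc d) *_) (+n/[1+d]≡n*1/suc n d) ⟩
    ℕ→ℚ (suc d) * (ℕ→ℚ n * 1/suc d)      ≡⟨ solve 3 (λ k n r → k :* (n :* r) := n :* (k :* r)) refl (ℕ→ℚ (suc d)) (ℕ→ℚ n) (1/suc d) ⟩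
    ℕ→ℚ n * (ℕ→ℚ (suc d) * 1/suc d)      ≡⟨ cong (ℕ→ℚ n *_) (ℕ→ℚ*1/suc d) ⟩
    ℕ→ℚ n * 1ℚ                           ≡⟨ *-identityʳ (ℕ→ℚ n) ⟩
    ℕ→ℚ n                                ∎
    where open ≡-Reasoning

  ^-nonNeg : ∀ {x} n → 0ℚ ≤ x → 0ℚ ≤ x ^ n
  ^-nonNeg zero    0≤x = 0≤1
  ^-nonNeg (suc n) 0≤x = 0≤p*q 0≤x (^-nonNeg n 0≤x)

  ^-pos : ∀ {x} n → 0ℚ < x → 0ℚ < x ^ n
  ^-pos zero    0<x = 0<1
  ^-pos (suc n) 0<x = 0<p*q 0<x (^-pos n 0<x)

  ^-monoˡ-≤ : ∀ {x y} n → 0ℚ ≤ x → x ≤ y → x ^ n ≤ y ^ n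
  ^-monoˡ-≤ zero    0≤x x≤y = ≤-refl
  ^-monoˡ-≤ (suc n) 0≤x x≤y = *-mono-≤-0≤ 0≤x (^-nonNeg n 0≤x) x≤y (^-monoˡ-≤ n 0≤x x≤y)

  ^-monoˡ-< : ∀ {x y} n → 0ℚ ≤ x → x < y → x ^ suc n < y ^ suc n
  ^-monoˡ-< {x} {y} zero    0≤x x<y = subst₂ _<_ (sym (*-identityʳ x)) (sym (*-identityʳ y)) x<y
  ^-monoˡ-< {x} {y} (suc n) 0≤x x<y =
    ≤-<-trans (*-monoʳ-≤-0≤ (^-nonNeg (suc n) 0≤x) (<⇒≤ x<y))
              (*-monoˡ-<-0< (≤-<-trans 0≤x x<y) (^-monoˡ-< n 0≤x x<y))

  ^-cancelˡ-≤ : ∀ {x y} n → 0ℚ ≤ y → x ^ suc n ≤ y ^ suc n → x ≤ y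
  ^-cancelˡ-≤ {x} {y} n 0≤y xⁿ≤yⁿ with x ≤? y
  ... | yes x≤y = x≤y
  ... | no x≰y = ⊥-elim (<-irrefl refl (<-≤-trans (^-monoˡ-< n 0≤y (≰⇒> x≰y)) xⁿ≤yⁿ))

  ^-monoʳ-≤ : ∀ {x m n} → 1ℚ ≤ x → m ℕ.≤ n → x ^ m ≤ x ^ n
  ^-monoʳ-≤ {x} {zero}  {zero}  1≤x z≤n = ≤-refl
  ^-monoʳ-≤ {x} {zero}  {suc n} 1≤x z≤n =
    *-mono-≤-0≤ 0≤1 0≤1 1≤x (^-monoʳ-≤ {x} {zero} {n} 1≤x z≤n)
  ^-monoʳ-≤ {x} {suc m} {suc n} 1≤x (s≤s m≤n) = *-monoˡ-≤-0≤ (≤-trans 0≤1 1≤x) (^-monoʳ-≤ 1≤x m≤n)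

  ^-antimonoʳ-≤ : ∀ {x m n} → 0ℚ ≤ x → x ≤ 1ℚ → m ℕ.≤ n → x ^ n ≤ x ^ m
  ^-antimonoʳ-≤ {x} {zero}  {zero}  0≤x x≤1 z≤n = ≤-refl
  ^-antimonoʳ-≤ {x} {zero}  {suc n} 0≤x x≤1 z≤n =
    *-mono-≤-0≤ 0≤x (^-nonNeg n 0≤x) x≤1 (^-antimonoʳ-≤ {x} {zero} {n} 0≤x x≤1 z≤n)
  ^-antimonoʳ-≤ {x} {suc m} {suc n} 0≤x x≤1 (s≤s m≤n) = *-monoˡ-≤-0≤ 0≤x (^-antimonoʳ-≤ 0≤x x≤1 m≤n)

  x^n≤1 : ∀ {x} n → 0ℚ ≤ x → x ≤ 1ℚ → x ^ n ≤ 1ℚ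
  x^n≤1 {x} n 0≤x x≤1 = ^-antimonoʳ-≤ {x} {0} {n} 0≤x x≤1 z≤n

  -- Rational exponents: h ≤ t ^ (e / (1 + d)), stated with integer exponents.
  ^-root-≤ : ∀ {h t} d e m k → 0ℚ ≤ h → 0ℚ ≤ t → h ^ suc d ≤ t ^ e →
             t ^ (e ℕ.* m) ≤ t ^ (suc d ℕ.* k) → h ^ m ≤ t ^ k
  ^-root-≤ {h} {t} d e m k 0≤h 0≤t hᵈ≤tᵉ tᵉᵐ≤tᵈᵏ = ^-cancelˡ-≤ d (^-nonNeg k 0≤t) (begin
    (h ^ m) ^ suc d    ≡⟨ ^-assocʳ h m (suc d) ⟩
    h ^ (m ℕ.* suc d)  ≡⟨ cong (h ^_) (ℕ.*-comm m (suc d)) ⟩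
    h ^ (suc d ℕ.* m)  ≡⟨ sym (^-assocʳ h (suc d) m) ⟩
    (h ^ suc d) ^ m    ≤⟨ ^-monoˡ-≤ m (^-nonNeg (suc d) 0≤h) hᵈ≤tᵉ ⟩
    (t ^ e) ^ m        ≡⟨ ^-assocʳ t e m ⟩
    t ^ (e ℕ.* m)      ≤⟨ tᵉᵐ≤tᵈᵏ ⟩
    t ^ (suc d ℕ.* k)  ≡⟨ cong (t ^_) (ℕ.*-comm (suc d) k) ⟩
    t ^ (k ℕ.* suc d)  ≡⟨ sym (^-assocʳ t k (suc d)) ⟩
    (t ^ k) ^ suc d    ∎)
    where open ≤-Reasoning

  -- One step of AM-GM: k copies of x and one of (1 + k)a - kx have mean a.
  x^k*[[1+k]a-kx]≤a^[1+k] : ∀ {a x} k → 0ℚ ≤ a → 0ℚ ≤ x →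
                            x ^ k * (ℕ→ℚ (suc k) * a - ℕ→ℚ k * x) ≤ a ^ suc k
  x^k*[[1+k]a-kx]≤a^[1+k] {a} {x} zero    0≤a 0≤x =
    ≤-reflexive (solve 2 (λ a x → con 1ℚ :* (con 1ℚ :* a :- con 0ℚ :* x) := a :* con 1ℚ) refl a x)
  x^k*[[1+k]a-kx]≤a^[1+k] {a} {x} (suc k) 0≤a 0≤x = begin
    x ^ suc k * (ℕ→ℚ (2 ℕ.+ k) * a - ℕ→ℚ (suc k) * x)  ≡⟨ cong (λ p → x ^ suc k * (p * a - K′ * x)) (ℕ→ℚ-suc (suc k)) ⟩
    x ^ suc k * ((1ℚ + K′) * a - K′ * x)               ≡⟨ identity ⟩
    a * (x ^ k * (K′ * a - K * x)) - K′ * x ^ k * ((a - x) * (a - x))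
                                                        ≤⟨ p-q≤p (0≤p*q (0≤p*q (ℕ→ℚ-nonNeg (suc k)) (^-nonNeg k 0≤x)) (0≤p*p (a - x))) ⟩
    a * (x ^ k * (K′ * a - K * x))                      ≤⟨ *-monoˡ-≤-0≤ 0≤a (x^k*[[1+k]a-kx]≤a^[1+k] k 0≤a 0≤x) ⟩
    a * a ^ suc k                                       ∎
    where
    open ≤-Reasoning
    K  = ℕ→ℚ k
    K′ = ℕ→ℚ (suc k)
    identity : x ^ suc k * ((1ℚ + K′) * a - K′ * x) ≡ a * (x ^ k * (K′ * a - K * x)) - K′ * x ^ k * ((a - x) * (a - x))
    identity = trans (cong (λ q → x * x ^ k * ((1ℚ + q) * a - q * x)) (ℕ→ℚ-suc k))
               (trans (solve 4 (λ a x k p → x :* p :* ((con 1ℚ :+ (con 1ℚ :+ k)) :* a :- (con 1ℚ :+ k) :* x) :=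
                                            a :* (p :* ((con 1ℚ :+ k) :* a :- k :* x)) :- (con 1ℚ :+ k) :* p :* ((a :- x) :* (a :- x)))
                               refl a x K (x ^ k))
                      (cong (λ q → a * (x ^ k * (q * a - K * x)) - q * x ^ k * ((a - x) * (a - x))) (sym (ℕ→ℚ-suc k))))

  -- The mean of n copies of x and i ones (junk value x when n = i = 0).
  meanWithOnes : ℚ → ℕ → ℕ → ℚ
  meanWithOnes x n zero    = x
  meanWithOnes x n (suc i) = (ℕ→ℚ (i ℕ.+ n) * meanWithOnes x n i + 1ℚ) * 1/suc (i ℕ.+ n)

  meanWithOnes-nonNeg : ∀ {x} n i → 0ℚ ≤ x → 0ℚ ≤ meanWithOnes x n i
  meanWithOnes-nonNeg n zero    0≤x = 0≤x
  meanWithOnes-nonNeg n (suc i) 0≤x =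
    0≤p*q (0≤p+q (0≤p*q (ℕ→ℚ-nonNeg (i ℕ.+ n)) (meanWithOnes-nonNeg n i 0≤x)) 0≤1) (1/suc-nonNeg (i ℕ.+ n))

  [1+i+n]*meanWithOnes : ∀ x n i → ℕ→ℚ (suc i ℕ.+ n) * meanWithOnes x n (suc i) ≡ ℕ→ℚ (i ℕ.+ n) * meanWithOnes x n i + 1ℚ
  [1+i+n]*meanWithOnes x n i = begin
    ℕ→ℚ (suc m) * (s * 1/suc m)    ≡⟨ solve 3 (λ k s r → k :* (s :* r) := s :* (k :* r)) refl (ℕ→ℚ (suc m)) s (1/suc m) ⟩
    s * (ℕ→ℚ (suc m) * 1/suc m)    ≡⟨ cong (s *_) (ℕ→ℚ*1/suc m) ⟩
    s * 1ℚ                         ≡⟨ *-identityʳ s ⟩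
    s                              ∎
    where
    open ≡-Reasoning
    m = i ℕ.+ n
    s = ℕ→ℚ m * meanWithOnes x n i + 1ℚ

  [i+n]*meanWithOnes : ∀ x n i → ℕ→ℚ (i ℕ.+ n) * meanWithOnes x n i ≡ ℕ→ℚ n * x + ℕ→ℚ i
  [i+n]*meanWithOnes x n zero    = sym (+-identityʳ (ℕ→ℚ n * x))
  [i+n]*meanWithOnes x n (suc i) = begin
    ℕ→ℚ (suc i ℕ.+ n) * meanWithOnes x n (suc i)   ≡⟨ [1+i+n]*meanWithOnes x n i ⟩
    ℕ→ℚ (i ℕ.+ n) * meanWithOnes x n i + 1ℚ        ≡⟨ cong (_+ 1ℚ) ([i+n]*meanWithOnes x n i) ⟩
    ℕ→ℚ n * x + ℕ→ℚ i + 1ℚ                         ≡⟨ +-assoc (ℕ→ℚ n * x) (ℕ→ℚ i) 1ℚ ⟩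
    ℕ→ℚ n * x + (ℕ→ℚ i + 1ℚ)                       ≡⟨ cong (ℕ→ℚ n * x +_) (+-comm (ℕ→ℚ i) 1ℚ) ⟩
    ℕ→ℚ n * x + (1ℚ + ℕ→ℚ i)                       ≡⟨ cong (ℕ→ℚ n * x +_) (sym (ℕ→ℚ-suc i)) ⟩
    ℕ→ℚ n * x + ℕ→ℚ (suc i)                        ∎
    where open ≡-Reasoning

  x^n≤meanWithOnes^[i+n] : ∀ {x} n i → 0ℚ ≤ x → x ^ n ≤ meanWithOnes x n i ^ (i ℕ.+ n)
  x^n≤meanWithOnes^[i+n] n zero    0≤x = ≤-refl
  x^n≤meanWithOnes^[i+n] {x} n (suc i) 0≤x = ≤-trans (x^n≤meanWithOnes^[i+n] n i 0≤x) (begin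
    μ ^ m                                           ≡⟨ sym (*-identityʳ (μ ^ m)) ⟩
    μ ^ m * 1ℚ                                      ≡⟨ cong (μ ^ m *_) (sym [1+m]μ′-mμ≡1) ⟩
    μ ^ m * (ℕ→ℚ (suc m) * μ′ - ℕ→ℚ m * μ)          ≤⟨ x^k*[[1+k]a-kx]≤a^[1+k] m 0≤μ′ 0≤μ ⟩
    μ′ ^ suc m                                      ∎)
    where
    open ≤-Reasoning
    m  = i ℕ.+ n
    μ  = meanWithOnes x n i
    μ′ = meanWithOnes x n (suc i)
    0≤μ  = meanWithOnes-nonNeg n i 0≤x
    0≤μ′ = meanWithOnes-nonNeg n (suc i) 0≤x
    [1+m]μ′-mμ≡1 : ℕ→ℚ (suc m) * μ′ - ℕ→ℚ m * μ ≡ 1ℚ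
    [1+m]μ′-mμ≡1 = trans (cong (_- ℕ→ℚ m * μ) ([1+i+n]*meanWithOnes x n i))
                         (solve 1 (λ s → (s :+ con 1ℚ) :- s := con 1ℚ) refl (ℕ→ℚ m * μ))

  amgm-ones : ∀ {x y} q n j → 0ℚ ≤ x → n ℕ.+ j ≡ suc q →
              ℕ→ℚ (suc q) * y ≡ ℕ→ℚ n * x + ℕ→ℚ j → x ^ n ≤ y ^ suc q
  amgm-ones {x} {y} q n j 0≤x n+j≡1+q [1+q]y≡nx+j =
    subst₂ (λ μ m → x ^ n ≤ μ ^ m) μ≡y j+n≡1+q (x^n≤meanWithOnes^[i+n] n j 0≤x)
    where
    j+n≡1+q : j ℕ.+ n ≡ suc q
    j+n≡1+q = trans (ℕ.+-comm j n) n+j≡1+q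
    [1+q]μ≡[1+q]y : ℕ→ℚ (suc q) * meanWithOnes x n j ≡ ℕ→ℚ (suc q) * y
    [1+q]μ≡[1+q]y = trans (subst (λ m → ℕ→ℚ m * meanWithOnes x n j ≡ ℕ→ℚ n * x + ℕ→ℚ j) j+n≡1+q ([i+n]*meanWithOnes x n j))
                         (sym [1+q]y≡nx+j)
    μ≡y : meanWithOnes x n j ≡ y
    μ≡y = ≤-antisym (*-cancelˡ-≤-0< (ℕ→ℚ-pos q) (≤-reflexive [1+q]μ≡[1+q]y))
                    (*-cancelˡ-≤-0< (ℕ→ℚ-pos q) (≤-reflexive (sym [1+q]μ≡[1+q]y)))

  g*c≤t^s⇒t^e≤c^Q⇒g^Q≤t^f : ∀ {g c t} Q s e f → 0ℚ ≤ g → 0ℚ ≤ c → 0ℚ < t →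
                              g * c ≤ t ^ s → t ^ e ≤ c ^ Q → e ℕ.+ f ≡ s ℕ.* Q → g ^ Q ≤ t ^ f
  g*c≤t^s⇒t^e≤c^Q⇒g^Q≤t^f {g} {c} {t} Q s e f 0≤g 0≤c 0<t gc≤tˢ tᵉ≤cᑫ e+f≡sQ = *-cancelˡ-≤-0< (^-pos e 0<t) (begin
    t ^ e * g ^ Q        ≡⟨ *-comm (t ^ e) (g ^ Q) ⟩
    g ^ Q * t ^ e        ≤⟨ *-monoˡ-≤-0≤ (^-nonNeg Q 0≤g) tᵉ≤cᑫ ⟩
    g ^ Q * c ^ Q        ≡⟨ sym (^-distrib-* g c Q) ⟩
    (g * c) ^ Q          ≤⟨ ^-monoˡ-≤ Q (0≤p*q 0≤g 0≤c) gc≤tˢ ⟩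
    (t ^ s) ^ Q          ≡⟨ ^-assocʳ t s Q ⟩
    t ^ (s ℕ.* Q)        ≡⟨ cong (t ^_) (sym e+f≡sQ) ⟩
    t ^ (e ℕ.+ f)        ≡⟨ ^-homo-* t e f ⟩
    t ^ e * t ^ f        ∎)
    where open ≤-Reasoning

  -- Partial sums of the exponential series

  partialSum : (ℕ → ℚ) → ℕ → ℚ
  partialSum f zero    = 0ℚ
  partialSum f (suc n) = partialSum f n + f n

  partialSum-cong : ∀ {f g} n → (∀ i → f i ≡ g i) → partialSum f n ≡ partialSum g n
  partialSum-cong zero    f≗g = refl
  partialSum-cong (suc n) f≗g = cong₂ _+_ (partialSum-cong n f≗g) (f≗g n)

  partialSum-distrib-+ : ∀ f g n → partialSum (λ i → f i + g i) n ≡ partialSum f n + partialSum g n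
  partialSum-distrib-+ f g zero    = refl
  partialSum-distrib-+ f g (suc n) rewrite partialSum-distrib-+ f g n =
    solve 4 (λ a b c d → (a :+ b) :+ (c :+ d) := (a :+ c) :+ (b :+ d)) refl
      (partialSum f n) (partialSum g n) (f n) (g n)

  partialSum-* : ∀ c f n → partialSum (λ i → c * f i) n ≡ c * partialSum f n
  partialSum-* c f zero    = sym (*-zeroʳ c)
  partialSum-* c f (suc n) rewrite partialSum-* c f n = sym (*-distribˡ-+ c (partialSum f n) (f n))

  partialSum-suc : ∀ f n → partialSum f (suc n) ≡ f 0 + partialSum (λ i → f (suc i)) n
  partialSum-suc f zero    = trans (+-identityˡ (f 0)) (sym (+-identityʳ (f 0)))
  partialSum-suc f (suc n) rewrite partialSum-suc f n = +-assoc (f 0) _ _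

  partialSum-nonNeg : ∀ {f} n → (∀ i → 0ℚ ≤ f i) → 0ℚ ≤ partialSum f n
  partialSum-nonNeg zero    0≤f = ≤-refl
  partialSum-nonNeg (suc n) 0≤f = 0≤p+q (partialSum-nonNeg n 0≤f) (0≤f n)

  partialSum-monoʳ-≤ : ∀ {f} → (∀ i → 0ℚ ≤ f i) → ∀ {m n} → m ℕ.≤ n → partialSum f m ≤ partialSum f n
  partialSum-monoʳ-≤ 0≤f {n = zero} z≤n = ≤-refl
  partialSum-monoʳ-≤ 0≤f {m} {suc n} m≤1+n with ℕ.m≤n⇒m<n∨m≡n m≤1+n
  ... | inj₁ (s≤s m≤n) = ≤-trans (partialSum-monoʳ-≤ 0≤f m≤n) (p≤p+q (0≤f n))
  ... | inj₂ refl      = ≤-refl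

  -- antidiagonalSum h n = Σ_{i+j=n} h i j  and  triangleSum h n = Σ_{i+j<n} h i j.
  antidiagonalSum : (ℕ → ℕ → ℚ) → ℕ → ℚ
  antidiagonalSum h zero    = h 0 0
  antidiagonalSum h (suc n) = h 0 (suc n) + antidiagonalSum (λ i → h (suc i)) n

  antidiagonalSum-cong : ∀ {h h′} n → (∀ i j → i ℕ.+ j ≡ n → h i j ≡ h′ i j) →
                         antidiagonalSum h n ≡ antidiagonalSum h′ n
  antidiagonalSum-cong zero    h≗h′ = h≗h′ 0 0 refl
  antidiagonalSum-cong (suc n) h≗h′ =
    cong₂ _+_ (h≗h′ 0 (suc n) refl) (antidiagonalSum-cong n (λ i j eq → h≗h′ (suc i) j (cong suc eq)))

  antidiagonalSum-distrib-+ : ∀ h h′ n → antidiagonalSum (λ i j → h i j + h′ i j) n ≡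
                              antidiagonalSum h n + antidiagonalSum h′ n
  antidiagonalSum-distrib-+ h h′ zero    = refl
  antidiagonalSum-distrib-+ h h′ (suc n)
    rewrite antidiagonalSum-distrib-+ (λ i → h (suc i)) (λ i → h′ (suc i)) n =
    solve 4 (λ a b c d → (a :+ b) :+ (c :+ d) := (a :+ c) :+ (b :+ d)) refl
      (h 0 (suc n)) (h′ 0 (suc n)) (antidiagonalSum (λ i → h (suc i)) n) (antidiagonalSum (λ i → h′ (suc i)) n)

  antidiagonalSum-* : ∀ c h n → antidiagonalSum (λ i j → c * h i j) n ≡ c * antidiagonalSum h n
  antidiagonalSum-* c h zero    = refl
  antidiagonalSum-* c h (suc n) rewrite antidiagonalSum-* c (λ i → h (suc i)) n =
    sym (*-distribˡ-+ c (h 0 (suc n)) (antidiagonalSum (λ i → h (suc i)) n))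

  antidiagonalSum-last : ∀ h n → antidiagonalSum h (suc n) ≡
                         antidiagonalSum (λ i j → h i (suc j)) n + h (suc n) 0
  antidiagonalSum-last h zero    = refl
  antidiagonalSum-last h (suc n) rewrite antidiagonalSum-last (λ i → h (suc i)) n =
    sym (+-assoc (h 0 (suc (suc n))) (antidiagonalSum (λ i j → h (suc i) (suc j)) n) (h (suc (suc n)) 0))

  antidiagonalSum-index-split : ∀ (h : ℕ → ℕ → ℚ) n → antidiagonalSum (λ i j → ℕ→ℚ n * h i j) n ≡
                                antidiagonalSum (λ i j → ℕ→ℚ i * h i j) n + antidiagonalSum (λ i j → ℕ→ℚ j * h i j) n
  antidiagonalSum-index-split h n =
    trans (antidiagonalSum-cong n split) (antidiagonalSum-distrib-+ (λ i j → ℕ→ℚ i * h i j) (λ i j → ℕ→ℚ j * h i j) n)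
    where
    split : ∀ i j → i ℕ.+ j ≡ n → ℕ→ℚ n * h i j ≡ ℕ→ℚ i * h i j + ℕ→ℚ j * h i j
    split i j i+j≡n = begin
      ℕ→ℚ n * h i j                  ≡⟨ cong (λ k → ℕ→ℚ k * h i j) (sym i+j≡n) ⟩
      ℕ→ℚ (i ℕ.+ j) * h i j          ≡⟨ cong (_* h i j) (ℕ→ℚ-homo-+ i j) ⟩
      (ℕ→ℚ i + ℕ→ℚ j) * h i j        ≡⟨ *-distribʳ-+ (h i j) (ℕ→ℚ i) (ℕ→ℚ j) ⟩
      ℕ→ℚ i * h i j + ℕ→ℚ j * h i j  ∎
      where open ≡-Reasoning

  antidiagonalSum-ℕ→ℚ[i]* : ∀ (h : ℕ → ℕ → ℚ) n → antidiagonalSum (λ i j → ℕ→ℚ i * h i j) (suc n) ≡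
                            antidiagonalSum (λ i j → ℕ→ℚ (suc i) * h (suc i) j) n
  antidiagonalSum-ℕ→ℚ[i]* h n =
    trans (cong (_+ antidiagonalSum (λ i j → ℕ→ℚ (suc i) * h (suc i) j) n) (*-zeroˡ (h 0 (suc n)))) (+-identityˡ _)

  antidiagonalSum-ℕ→ℚ[j]* : ∀ (h : ℕ → ℕ → ℚ) n → antidiagonalSum (λ i j → ℕ→ℚ j * h i j) (suc n) ≡
                            antidiagonalSum (λ i j → ℕ→ℚ (suc j) * h i (suc j)) n
  antidiagonalSum-ℕ→ℚ[j]* h n =
    trans (antidiagonalSum-last (λ i j → ℕ→ℚ j * h i j) n)
          (trans (cong (antidiagonalSum (λ i j → ℕ→ℚ (suc j) * h i (suc j)) n +_) (*-zeroˡ (h (suc n) 0))) (+-identityʳ _))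

  triangleSum : (ℕ → ℕ → ℚ) → ℕ → ℚ
  triangleSum h zero    = 0ℚ
  triangleSum h (suc n) = partialSum (h 0) (suc n) + triangleSum (λ i → h (suc i)) n

  partialSum-antidiagonalSum : ∀ h n → partialSum (antidiagonalSum h) n ≡ triangleSum h n
  partialSum-antidiagonalSum h zero    = refl
  partialSum-antidiagonalSum h (suc n) = begin
    partialSum (antidiagonalSum h) (suc n)
      ≡⟨ partialSum-suc (antidiagonalSum h) n ⟩
    h 0 0 + partialSum (λ i → h 0 (suc i) + antidiagonalSum (λ i → h (suc i)) i) n
      ≡⟨ cong (h 0 0 +_) (partialSum-distrib-+ (λ i → h 0 (suc i)) (antidiagonalSum (λ i → h (suc i))) n) ⟩
    h 0 0 + (partialSum (λ i → h 0 (suc i)) n + partialSum (antidiagonalSum (λ i → h (suc i))) n)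
      ≡⟨ sym (+-assoc (h 0 0) _ _) ⟩
    (h 0 0 + partialSum (λ i → h 0 (suc i)) n) + partialSum (antidiagonalSum (λ i → h (suc i))) n
      ≡⟨ cong₂ _+_ (sym (partialSum-suc (h 0) n)) (partialSum-antidiagonalSum (λ i → h (suc i)) n) ⟩
    triangleSum h (suc n) ∎
    where open ≡-Reasoning

  triangleSum-nonNeg : ∀ (f g : ℕ → ℚ) → (∀ i → 0ℚ ≤ f i) → (∀ j → 0ℚ ≤ g j) →
                       ∀ n → 0ℚ ≤ triangleSum (λ i j → f i * g j) n
  triangleSum-nonNeg f g 0≤f 0≤g zero    = ≤-refl
  triangleSum-nonNeg f g 0≤f 0≤g (suc n) =
    0≤p+q (partialSum-nonNeg {λ j → f 0 * g j} (suc n) (λ j → 0≤p*q (0≤f 0) (0≤g j)))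
          (triangleSum-nonNeg (λ i → f (suc i)) g (λ i → 0≤f (suc i)) 0≤g n)

  triangleSum-≤-* : ∀ (f g : ℕ → ℚ) → (∀ i → 0ℚ ≤ f i) → (∀ j → 0ℚ ≤ g j) →
                    ∀ n → triangleSum (λ i j → f i * g j) n ≤ partialSum f n * partialSum g n
  triangleSum-≤-* f g 0≤f 0≤g zero    = ≤-reflexive (sym (*-zeroˡ 0ℚ))
  triangleSum-≤-* f g 0≤f 0≤g (suc n) = begin
    partialSum (λ j → f 0 * g j) (suc n) + triangleSum (λ i j → f (suc i) * g j) n
      ≤⟨ +-mono-≤ (≤-reflexive (partialSum-* (f 0) g (suc n))) (triangleSum-≤-* f′ g (λ i → 0≤f (suc i)) 0≤g n) ⟩
    f 0 * partialSum g (suc n) + partialSum f′ n * partialSum g n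
      ≤⟨ +-monoʳ-≤ (f 0 * partialSum g (suc n))
           (*-monoˡ-≤-0≤ (partialSum-nonNeg {f′} n (λ i → 0≤f (suc i))) (partialSum-monoʳ-≤ 0≤g (ℕ.n≤1+n n))) ⟩
    f 0 * partialSum g (suc n) + partialSum f′ n * partialSum g (suc n)
      ≡⟨ sym (*-distribʳ-+ (partialSum g (suc n)) (f 0) (partialSum f′ n)) ⟩
    (f 0 + partialSum f′ n) * partialSum g (suc n)
      ≡⟨ cong (_* partialSum g (suc n)) (sym (partialSum-suc f n)) ⟩
    partialSum f (suc n) * partialSum g (suc n) ∎
    where
    open ≤-Reasoning
    f′ = λ i → f (suc i)

  *-≤-triangleSum : ∀ (f g : ℕ → ℚ) → (∀ i → 0ℚ ≤ f i) → (∀ j → 0ℚ ≤ g j) →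
                    ∀ m n → partialSum f m * partialSum g n ≤ triangleSum (λ i j → f i * g j) (m ℕ.+ n)
  *-≤-triangleSum f g 0≤f 0≤g zero    n =
    ≤-trans (≤-reflexive (*-zeroˡ (partialSum g n))) (triangleSum-nonNeg f g 0≤f 0≤g n)
  *-≤-triangleSum f g 0≤f 0≤g (suc m) n = begin
    partialSum f (suc m) * partialSum g n
      ≡⟨ cong (_* partialSum g n) (partialSum-suc f m) ⟩
    (f 0 + partialSum f′ m) * partialSum g n
      ≡⟨ *-distribʳ-+ (partialSum g n) (f 0) (partialSum f′ m) ⟩
    f 0 * partialSum g n + partialSum f′ m * partialSum g n
      ≤⟨ +-mono-≤ (*-monoˡ-≤-0≤ (0≤f 0) (partialSum-monoʳ-≤ 0≤g (ℕ.m≤n+m n (suc m))))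
                  (*-≤-triangleSum f′ g (λ i → 0≤f (suc i)) 0≤g m n) ⟩
    f 0 * partialSum g (suc m ℕ.+ n) + triangleSum (λ i j → f (suc i) * g j) (m ℕ.+ n)
      ≡⟨ cong (_+ triangleSum (λ i j → f (suc i) * g j) (m ℕ.+ n)) (sym (partialSum-* (f 0) g (suc m ℕ.+ n))) ⟩
    triangleSum (λ i j → f i * g j) (suc m ℕ.+ n) ∎
    where
    open ≤-Reasoning
    f′ = λ i → f (suc i)

  expPartial≡partialSum : ∀ x n → expPartial x n ≡ partialSum (expTerm x) n
  expPartial≡partialSum x zero    = refl
  expPartial≡partialSum x (suc n) = cong (_+ expTerm x n) (expPartial≡partialSum x n)

  expTerm-nonNeg : ∀ {x} k → 0ℚ ≤ x → 0ℚ ≤ expTerm x k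
  expTerm-nonNeg zero    0≤x = 0≤1
  expTerm-nonNeg (suc k) 0≤x = 0≤p*q (expTerm-nonNeg k 0≤x) (0≤p*q 0≤x (1/suc-nonNeg k))

  expPartial-nonNeg : ∀ {x} n → 0ℚ ≤ x → 0ℚ ≤ expPartial x n
  expPartial-nonNeg zero    0≤x = ≤-refl
  expPartial-nonNeg (suc n) 0≤x = 0≤p+q (expPartial-nonNeg n 0≤x) (expTerm-nonNeg n 0≤x)

  expTerm-monoˡ-≤ : ∀ {x y} k → 0ℚ ≤ x → x ≤ y → expTerm x k ≤ expTerm y k
  expTerm-monoˡ-≤ zero    0≤x x≤y = ≤-refl
  expTerm-monoˡ-≤ (suc k) 0≤x x≤y =
    *-mono-≤-0≤ (expTerm-nonNeg k 0≤x) (0≤p*q 0≤x (1/suc-nonNeg k))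
                (expTerm-monoˡ-≤ k 0≤x x≤y) (*-monoʳ-≤-0≤ (1/suc-nonNeg k) x≤y)

  expPartial-monoˡ-≤ : ∀ {x y} n → 0ℚ ≤ x → x ≤ y → expPartial x n ≤ expPartial y n
  expPartial-monoˡ-≤ zero    0≤x x≤y = ≤-refl
  expPartial-monoˡ-≤ (suc n) 0≤x x≤y = +-mono-≤ (expPartial-monoˡ-≤ n 0≤x x≤y) (expTerm-monoˡ-≤ n 0≤x x≤y)

  expPartial-monoʳ-≤ : ∀ {x m n} → 0ℚ ≤ x → m ℕ.≤ n → expPartial x m ≤ expPartial x n
  expPartial-monoʳ-≤ {x} {m} {n} 0≤x m≤n =
    subst₂ _≤_ (sym (expPartial≡partialSum x m)) (sym (expPartial≡partialSum x n))
      (partialSum-monoʳ-≤ (λ i → expTerm-nonNeg i 0≤x) m≤n)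

  expTerm-≤-^ : ∀ {x} k → 0ℚ ≤ x → expTerm x k ≤ x ^ k
  expTerm-≤-^ zero    0≤x = ≤-refl
  expTerm-≤-^ {x} (suc k) 0≤x = begin
    expTerm x k * (x * 1/suc k)  ≤⟨ *-mono-≤-0≤ (expTerm-nonNeg k 0≤x) (0≤p*q 0≤x (1/suc-nonNeg k))
                                      (expTerm-≤-^ k 0≤x) (*-monoˡ-≤-0≤ 0≤x (1/suc≤1 k)) ⟩
    x ^ k * (x * 1ℚ)             ≡⟨ solve 2 (λ p x → p :* (x :* con 1ℚ) := x :* p) refl (x ^ k) x ⟩
    x * x ^ k                    ∎
    where open ≤-Reasoning

  expPartial-2 : ∀ x → expPartial x 2 ≡ 1ℚ + x
  expPartial-2 = solve 1 (λ x → (con 0ℚ :+ con 1ℚ) :+ con 1ℚ :* (x :* con 1ℚ) := con 1ℚ :+ x) refl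

  expPartial-3 : ∀ x → expPartial x 3 ≡ 1ℚ + x + x * x * ½
  expPartial-3 = solve 1 (λ x → ((con 0ℚ :+ con 1ℚ) :+ con 1ℚ :* (x :* con 1ℚ)) :+ (con 1ℚ :* (x :* con 1ℚ)) :* (x :* con ½) :=
                                con 1ℚ :+ x :+ x :* x :* con ½) refl

  expTerm-2 : ∀ x → expTerm x 2 ≡ x * x * ½
  expTerm-2 = solve 1 (λ x → (con 1ℚ :* (x :* con 1ℚ)) :* (x :* con ½) := x :* x :* con ½) refl

  ℕ→ℚ*expTerm-suc : ∀ x k → ℕ→ℚ (suc k) * expTerm x (suc k) ≡ x * expTerm x k
  ℕ→ℚ*expTerm-suc x k = begin
    ℕ→ℚ (suc k) * (expTerm x k * (x * 1/suc k))
      ≡⟨ solve 4 (λ n t x r → n :* (t :* (x :* r)) := (x :* t) :* (n :* r)) refl (ℕ→ℚ (suc k)) (expTerm x k) x (1/suc k) ⟩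
    (x * expTerm x k) * (ℕ→ℚ (suc k) * 1/suc k)  ≡⟨ cong ((x * expTerm x k) *_) (ℕ→ℚ*1/suc k) ⟩
    (x * expTerm x k) * 1ℚ                       ≡⟨ *-identityʳ _ ⟩
    x * expTerm x k                              ∎
    where open ≡-Reasoning

  expTerm-+-recurrence : ∀ u v n →
    ℕ→ℚ (suc n) * antidiagonalSum (λ i j → expTerm u i * expTerm v j) (suc n) ≡
    (u + v) * antidiagonalSum (λ i j → expTerm u i * expTerm v j) n
  expTerm-+-recurrence u v n = begin
    ℕ→ℚ (suc n) * c (suc n)                                       ≡⟨ sym (antidiagonalSum-* (ℕ→ℚ (suc n)) h (suc n)) ⟩
    antidiagonalSum (λ i j → ℕ→ℚ (suc n) * h i j) (suc n)         ≡⟨ antidiagonalSum-index-split h (suc n) ⟩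
    antidiagonalSum (λ i j → ℕ→ℚ i * h i j) (suc n) +
    antidiagonalSum (λ i j → ℕ→ℚ j * h i j) (suc n)               ≡⟨ cong₂ _+_ (antidiagonalSum-ℕ→ℚ[i]* h n) (antidiagonalSum-ℕ→ℚ[j]* h n) ⟩
    antidiagonalSum (λ i j → ℕ→ℚ (suc i) * h (suc i) j) n +
    antidiagonalSum (λ i j → ℕ→ℚ (suc j) * h i (suc j)) n         ≡⟨ cong₂ _+_ (antidiagonalSum-cong n (λ i j _ → left-step i j))
                                                                                (antidiagonalSum-cong n (λ i j _ → right-step i j)) ⟩
    antidiagonalSum (λ i j → u * h i j) n +
    antidiagonalSum (λ i j → v * h i j) n                         ≡⟨ cong₂ _+_ (antidiagonalSum-* u h n) (antidiagonalSum-* v h n) ⟩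
    u * c n + v * c n                                             ≡⟨ sym (*-distribʳ-+ (c n) u v) ⟩
    (u + v) * c n                                                 ∎
    where
    open ≡-Reasoning
    h : ℕ → ℕ → ℚ
    h i j = expTerm u i * expTerm v j
    c = antidiagonalSum h
    left-step : ∀ i j → ℕ→ℚ (suc i) * h (suc i) j ≡ u * h i j
    left-step i j = begin
      ℕ→ℚ (suc i) * (expTerm u (suc i) * expTerm v j)  ≡⟨ sym (*-assoc (ℕ→ℚ (suc i)) _ _) ⟩
      (ℕ→ℚ (suc i) * expTerm u (suc i)) * expTerm v j  ≡⟨ cong (_* expTerm v j) (ℕ→ℚ*expTerm-suc u i) ⟩
      (u * expTerm u i) * expTerm v j                  ≡⟨ *-assoc u _ _ ⟩
      u * h i j                                        ∎
    right-step : ∀ i j → ℕ→ℚ (suc j) * h i (suc j) ≡ v * h i j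
    right-step i j = begin
      ℕ→ℚ (suc j) * (expTerm u i * expTerm v (suc j))
        ≡⟨ solve 3 (λ k a b → k :* (a :* b) := a :* (k :* b)) refl (ℕ→ℚ (suc j)) (expTerm u i) (expTerm v (suc j)) ⟩
      expTerm u i * (ℕ→ℚ (suc j) * expTerm v (suc j))  ≡⟨ cong (expTerm u i *_) (ℕ→ℚ*expTerm-suc v j) ⟩
      expTerm u i * (v * expTerm v j)
        ≡⟨ solve 3 (λ a v b → a :* (v :* b) := v :* (a :* b)) refl (expTerm u i) v (expTerm v j) ⟩
      v * h i j                                        ∎

  expTerm-+ : ∀ u v n → antidiagonalSum (λ i j → expTerm u i * expTerm v j) n ≡ expTerm (u + v) n
  expTerm-+ u v zero    = refl
  expTerm-+ u v (suc n) = begin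
    c (suc n)                                  ≡⟨ sym (*-identityˡ (c (suc n))) ⟩
    1ℚ * c (suc n)                             ≡⟨ cong (_* c (suc n)) (sym (ℕ→ℚ*1/suc n)) ⟩
    (ℕ→ℚ (suc n) * 1/suc n) * c (suc n)        ≡⟨ solve 3 (λ k r c → (k :* r) :* c := r :* (k :* c)) refl (ℕ→ℚ (suc n)) (1/suc n) (c (suc n)) ⟩
    1/suc n * (ℕ→ℚ (suc n) * c (suc n))        ≡⟨ cong (1/suc n *_) (expTerm-+-recurrence u v n) ⟩
    1/suc n * ((u + v) * c n)                  ≡⟨ cong (λ t → 1/suc n * ((u + v) * t)) (expTerm-+ u v n) ⟩
    1/suc n * ((u + v) * expTerm (u + v) n)    ≡⟨ solve 3 (λ r w t → r :* (w :* t) := t :* (w :* r)) refl (1/suc n) (u + v) (expTerm (u + v) n) ⟩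
    expTerm (u + v) (suc n)                    ∎
    where
    open ≡-Reasoning
    c = antidiagonalSum (λ i j → expTerm u i * expTerm v j)

  expPartial-+ : ∀ u v n → expPartial (u + v) n ≡ triangleSum (λ i j → expTerm u i * expTerm v j) n
  expPartial-+ u v n = begin
    expPartial (u + v) n
      ≡⟨ expPartial≡partialSum (u + v) n ⟩
    partialSum (expTerm (u + v)) n
      ≡⟨ partialSum-cong n (λ i → sym (expTerm-+ u v i)) ⟩
    partialSum (antidiagonalSum (λ i j → expTerm u i * expTerm v j)) n
      ≡⟨ partialSum-antidiagonalSum (λ i j → expTerm u i * expTerm v j) n ⟩
    triangleSum (λ i j → expTerm u i * expTerm v j) n ∎
    where open ≡-Reasoning

  expPartial-+-≤-* : ∀ {u v} n → 0ℚ ≤ u → 0ℚ ≤ v → expPartial (u + v) n ≤ expPartial u n * expPartial v n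
  expPartial-+-≤-* {u} {v} n 0≤u 0≤v =
    subst₂ _≤_ (sym (expPartial-+ u v n))
               (sym (cong₂ _*_ (expPartial≡partialSum u n) (expPartial≡partialSum v n)))
      (triangleSum-≤-* (expTerm u) (expTerm v) (λ i → expTerm-nonNeg i 0≤u) (λ j → expTerm-nonNeg j 0≤v) n)

  *-≤-expPartial-+ : ∀ {u v} m n → 0ℚ ≤ u → 0ℚ ≤ v → expPartial u m * expPartial v n ≤ expPartial (u + v) (m ℕ.+ n)
  *-≤-expPartial-+ {u} {v} m n 0≤u 0≤v =
    subst₂ _≤_ (sym (cong₂ _*_ (expPartial≡partialSum u m) (expPartial≡partialSum v n)))
               (sym (expPartial-+ u v (m ℕ.+ n)))
      (*-≤-triangleSum (expTerm u) (expTerm v) (λ i → expTerm-nonNeg i 0≤u) (λ j → expTerm-nonNeg j 0≤v) m n)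

  expPartial-0≤1 : ∀ n → expPartial 0ℚ n ≤ 1ℚ
  expPartial-0≤1 zero    = 0≤1
  expPartial-0≤1 (suc n) = ≤-reflexive (expPartial0≡1 n)
    where
    expTerm0≡0 : ∀ k → expTerm 0ℚ (suc k) ≡ 0ℚ
    expTerm0≡0 k = trans (cong (expTerm 0ℚ k *_) (*-zeroˡ (1/suc k))) (*-zeroʳ (expTerm 0ℚ k))
    expPartial0≡1 : ∀ n → expPartial 0ℚ (suc n) ≡ 1ℚ
    expPartial0≡1 zero    = refl
    expPartial0≡1 (suc n) = trans (cong₂ _+_ (expPartial0≡1 n) (expTerm0≡0 n)) (+-identityʳ 1ℚ)

  expPartial-ℕ*-≤-^ : ∀ {u} k n → 0ℚ ≤ u → expPartial (ℕ→ℚ k * u) n ≤ expPartial u n ^ k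
  expPartial-ℕ*-≤-^ {u} zero    n 0≤u = subst (λ x → expPartial x n ≤ 1ℚ) (sym (*-zeroˡ u)) (expPartial-0≤1 n)
  expPartial-ℕ*-≤-^ {u} (suc k) n 0≤u = begin
    expPartial (ℕ→ℚ (suc k) * u) n           ≡⟨ cong (λ x → expPartial x n) (ℕ→ℚ-suc-* k u) ⟩
    expPartial (u + ℕ→ℚ k * u) n             ≤⟨ expPartial-+-≤-* n 0≤u (0≤p*q (ℕ→ℚ-nonNeg k) 0≤u) ⟩
    expPartial u n * expPartial (ℕ→ℚ k * u) n ≤⟨ *-monoˡ-≤-0≤ (expPartial-nonNeg n 0≤u) (expPartial-ℕ*-≤-^ k n 0≤u) ⟩
    expPartial u n * expPartial u n ^ k      ∎
    where open ≤-Reasoning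

  ^-≤-expPartial-ℕ* : ∀ {u} k n → 0ℚ ≤ u → Σ ℕ λ m → expPartial u n ^ k ≤ expPartial (ℕ→ℚ k * u) m
  ^-≤-expPartial-ℕ* {u} zero    n 0≤u = 1 , ≤-refl
  ^-≤-expPartial-ℕ* {u} (suc k) n 0≤u with ^-≤-expPartial-ℕ* k n 0≤u
  ... | m , uⁿᵏ≤ = n ℕ.+ m , (begin
    expPartial u n * expPartial u n ^ k        ≤⟨ *-monoˡ-≤-0≤ (expPartial-nonNeg n 0≤u) uⁿᵏ≤ ⟩
    expPartial u n * expPartial (ℕ→ℚ k * u) m  ≤⟨ *-≤-expPartial-+ n m 0≤u (0≤p*q (ℕ→ℚ-nonNeg k) 0≤u) ⟩
    expPartial (u + ℕ→ℚ k * u) (n ℕ.+ m)      ≡⟨ cong (λ x → expPartial x (n ℕ.+ m)) (sym (ℕ→ℚ-suc-* k u)) ⟩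
    expPartial (ℕ→ℚ (suc k) * u) (n ℕ.+ m)    ∎)
    where open ≤-Reasoning

  tailMajorant : ℕ → ℚ → ℕ → ℚ
  tailMajorant k w m = (ℕ→ℚ (suc k) - w) * expPartial w m + ℕ→ℚ (suc k) * expTerm w m

  [1+k]/[1+j+k]≤1 : ∀ k j → ℕ→ℚ (suc k) * 1/suc (j ℕ.+ k) ≤ 1ℚ
  [1+k]/[1+j+k]≤1 k j = ≤-trans (*-monoʳ-≤-0≤ (1/suc-nonNeg (j ℕ.+ k)) (ℕ→ℚ-mono-≤ (s≤s (ℕ.m≤n+m k j))))
                                (≤-reflexive (ℕ→ℚ*1/suc (j ℕ.+ k)))

  tailMajorant-step : ∀ k {w} j → 0ℚ ≤ w → tailMajorant k w (suc (j ℕ.+ k)) ≤ tailMajorant k w (j ℕ.+ k)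
  tailMajorant-step k {w} j 0≤w = begin
    c * (s + t) + K * (t * (w * ρ))     ≡⟨ regroup c s t K w ρ ⟩
    (c * s + c * t) + (w * t) * (K * ρ) ≤⟨ +-monoʳ-≤ (c * s + c * t) (*-monoˡ-≤-0≤ (0≤p*q 0≤w (expTerm-nonNeg (j ℕ.+ k) 0≤w)) ([1+k]/[1+j+k]≤1 k j)) ⟩
    (c * s + c * t) + (w * t) * 1ℚ      ≡⟨ collect K w s t ⟩
    tailMajorant k w (j ℕ.+ k)          ∎
    where
    open ≤-Reasoning
    K = ℕ→ℚ (suc k)
    c = K - w
    s = expPartial w (j ℕ.+ k)
    t = expTerm w (j ℕ.+ k)
    ρ = 1/suc (j ℕ.+ k)
    regroup : ∀ c s t K w r → c * (s + t) + K * (t * (w * r)) ≡ (c * s + c * t) + (w * t) * (K * r)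
    regroup = solve 6 (λ c s t K w r → c :* (s :+ t) :+ K :* (t :* (w :* r)) := (c :* s :+ c :* t) :+ (w :* t) :* (K :* r)) refl
    collect : ∀ K w s t → ((K - w) * s + (K - w) * t) + (w * t) * 1ℚ ≡ (K - w) * s + K * t
    collect = solve 4 (λ K w s t → ((K :- w) :* s :+ (K :- w) :* t) :+ (w :* t) :* con 1ℚ := (K :- w) :* s :+ K :* t) refl

  tailMajorant-antitone : ∀ k {w} j → 0ℚ ≤ w → tailMajorant k w (j ℕ.+ k) ≤ tailMajorant k w k
  tailMajorant-antitone k zero    0≤w = ≤-refl
  tailMajorant-antitone k (suc j) 0≤w = ≤-trans (tailMajorant-step k j 0≤w) (tailMajorant-antitone k j 0≤w)

  -- Beyond the k-th term the series is dominated by a geometric series of ratio w / (1 + k).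
  expPartial-tail : ∀ k {w} n → 0ℚ ≤ w → w ≤ ℕ→ℚ (suc k) →
                    (ℕ→ℚ (suc k) - w) * expPartial w n ≤ tailMajorant k w k
  expPartial-tail k {w} n 0≤w w≤1+k with ℕ.≤-total n k
  ... | inj₁ n≤k = ≤-trans (*-monoˡ-≤-0≤ (p≤q⇒0≤q-p w≤1+k) (expPartial-monoʳ-≤ 0≤w n≤k))
                           (p≤p+q (0≤p*q (ℕ→ℚ-nonNeg (suc k)) (expTerm-nonNeg k 0≤w)))
  ... | inj₂ k≤n = subst (λ m → (ℕ→ℚ (suc k) - w) * expPartial w m ≤ tailMajorant k w k) (ℕ.m∸n+n≡m k≤n)
                     (≤-trans (p≤p+q (0≤p*q (ℕ→ℚ-nonNeg (suc k)) (expTerm-nonNeg (n ℕ.∸ k ℕ.+ k) 0≤w)))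
                              (tailMajorant-antitone k (n ℕ.∸ k) 0≤w))

  expPartial-geometric : ∀ {r} n → 0ℚ ≤ r → r ≤ 1ℚ → (1ℚ - r) * expPartial r n ≤ 1ℚ
  expPartial-geometric {r} n 0≤r r≤1 = ≤-trans (p≤p+q (^-nonNeg n 0≤r)) (invariant n)
    where
    0≤1-r = p≤q⇒0≤q-p r≤1
    invariant : ∀ n → (1ℚ - r) * expPartial r n + r ^ n ≤ 1ℚ
    invariant zero    = ≤-reflexive (solve 1 (λ r → (con 1ℚ :- r) :* con 0ℚ :+ con 1ℚ := con 1ℚ) refl r)
    invariant (suc n) = begin
      (1ℚ - r) * (s + t) + r * r ^ n            ≡⟨ solve 4 (λ r s t p → (con 1ℚ :- r) :* (s :+ t) :+ r :* p :=
                                                             (con 1ℚ :- r) :* s :+ ((con 1ℚ :- r) :* t :+ r :* p)) refl r s t (r ^ n) ⟩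
      (1ℚ - r) * s + ((1ℚ - r) * t + r * r ^ n) ≤⟨ +-monoʳ-≤ ((1ℚ - r) * s) (+-monoˡ-≤ (r * r ^ n) (*-monoˡ-≤-0≤ 0≤1-r (expTerm-≤-^ n 0≤r))) ⟩
      (1ℚ - r) * s + ((1ℚ - r) * r ^ n + r * r ^ n) ≡⟨ solve 3 (λ r s p → (con 1ℚ :- r) :* s :+ ((con 1ℚ :- r) :* p :+ r :* p) :=
                                                             (con 1ℚ :- r) :* s :+ p) refl r s (r ^ n) ⟩
      (1ℚ - r) * s + r ^ n                      ≤⟨ invariant n ⟩
      1ℚ                                        ∎
      where
      open ≤-Reasoning
      s = expPartial r n
      t = expTerm r n

  <exp-mono : ∀ {K x x′} → K <exp x → 0ℚ ≤ x → x ≤ x′ → K <exp x′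
  <exp-mono (n , K<eˣ) 0≤x x≤x′ = n , <-≤-trans K<eˣ (expPartial-monoˡ-≤ n 0≤x x≤x′)

  -- Polynomial inequalities in γ

  γ̂ : Polynomial 1
  γ̂ = var zero

  -- (c , i , j) stands for c · γ ^ i · (1 - γ) ^ j, which is nonnegative for 0 ≤ γ ≤ 1.
  bernstein : List (ℕ × ℕ × ℕ) → Polynomial 1
  bernstein []                  = con 0ℚ
  bernstein ((c , i , j) ∷ cs) = con (ℕ→ℚ c) :* γ̂ :^ i :* (con 1ℚ :- γ̂) :^ j :+ bernstein cs

  bernstein-nonNeg : ∀ cs {γ} → 0ℚ ≤ γ → γ ≤ 1ℚ → 0ℚ ≤ ⟦ bernstein cs ⟧ (γ ∷ [])
  bernstein-nonNeg []                 0≤γ γ≤1 = ≤-refl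
  bernstein-nonNeg ((c , i , j) ∷ cs) 0≤γ γ≤1 =
    0≤p+q (0≤p*q (0≤p*q (ℕ→ℚ-nonNeg c) (^-nonNeg i 0≤γ)) (^-nonNeg j (p≤q⇒0≤q-p γ≤1)))
          (bernstein-nonNeg cs 0≤γ γ≤1)

  -- The premise compares normal forms of the ring solver, so it is proved by refl.
  ≤-by-bernstein : ∀ {γ} d cs (L R : Polynomial 1) → 0ℚ ≤ γ → γ ≤ 1ℚ →
                   ⟦ con (ℕ→ℚ (suc d)) :* (R :- L) ⟧↓ (γ ∷ []) ≡ ⟦ bernstein cs ⟧↓ (γ ∷ []) →
                   ⟦ L ⟧ (γ ∷ []) ≤ ⟦ R ⟧ (γ ∷ [])
  ≤-by-bernstein {γ} d cs L R 0≤γ γ≤1 normal-forms≡ =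
    0≤q-p⇒p≤q (*-cancelˡ-≤-0< (ℕ→ℚ-pos d) (begin
      ℕ→ℚ (suc d) * 0ℚ                      ≡⟨ *-zeroʳ (ℕ→ℚ (suc d)) ⟩
      0ℚ                                     ≤⟨ bernstein-nonNeg cs 0≤γ γ≤1 ⟩
      ⟦ bernstein cs ⟧ (γ ∷ [])              ≡⟨ sym (prove (γ ∷ []) (con (ℕ→ℚ (suc d)) :* (R :- L)) (bernstein cs) normal-forms≡) ⟩
      ℕ→ℚ (suc d) * (⟦ R ⟧ (γ ∷ []) - ⟦ L ⟧ (γ ∷ [])) ∎))
    where open ≤-Reasoning

  ¼ ⅓ 3ℚ : ℚ
  ¼  = ℤ.+ 1 / 4
  ⅓  = ℤ.+ 1 / 3
  3ℚ = ℕ→ℚ 3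

  0≤½ : 0ℚ ≤ ½
  0≤½ = nonNegative⁻¹ ½

  ½≤1 : ½ ≤ 1ℚ
  ½≤1 = from-yes (½ ≤? 1ℚ)

  -- Parameters of the Chernoff argument: the tilts 1 + v (upper tail) and 1 - u (lower tail),
  -- the exponent rate z = γ² / 3, and w = v + z, r = u - z.
  v z w u r : ℚ → ℚ
  v γ = γ - γ * γ * ¼
  z γ = γ * γ * ⅓
  w γ = v γ + z γ
  u γ = γ - γ * γ * ½
  r γ = u γ - z γ

  V Z W U R : Polynomial 1
  V = γ̂ :- γ̂ :* γ̂ :* con ¼
  Z = γ̂ :* γ̂ :* con ⅓
  W = V :+ Z
  U = γ̂ :- γ̂ :* γ̂ :* con ½
  R = U :- Z

  module ParameterBounds {γ : ℚ} (0≤γ : 0ℚ ≤ γ) (γ≤1 : γ ≤ 1ℚ) where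

    0≤v : 0ℚ ≤ v γ
    0≤v = ≤-by-bernstein 3 ((4 , 1 , 1) ∷ (3 , 2 , 0) ∷ []) (con 0ℚ) V 0≤γ γ≤1 refl

    0≤z : 0ℚ ≤ z γ
    0≤z = ≤-by-bernstein 2 ((1 , 2 , 0) ∷ []) (con 0ℚ) Z 0≤γ γ≤1 refl

    z≤1 : z γ ≤ 1ℚ
    z≤1 = ≤-by-bernstein 2 ((3 , 0 , 2) ∷ (6 , 1 , 1) ∷ (2 , 2 , 0) ∷ []) Z (con 1ℚ) 0≤γ γ≤1 refl

    1≤3-w : 1ℚ ≤ 3ℚ - w γ
    1≤3-w = ≤-by-bernstein 11 ((24 , 0 , 2) ∷ (36 , 1 , 1) ∷ (11 , 2 , 0) ∷ []) (con 1ℚ) (con 3ℚ :- W) 0≤γ γ≤1 refl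

    1≤1+v-γv : 1ℚ ≤ 1ℚ + v γ - γ * v γ
    1≤1+v-γv = ≤-by-bernstein 3 ((4 , 1 , 2) ∷ (3 , 2 , 1) ∷ []) (con 1ℚ) (con 1ℚ :+ V :- γ̂ :* V) 0≤γ γ≤1 refl

    0≤u : 0ℚ ≤ u γ
    0≤u = ≤-by-bernstein 1 ((2 , 1 , 1) ∷ (1 , 2 , 0) ∷ []) (con 0ℚ) U 0≤γ γ≤1 refl

    ½≤1-u : ½ ≤ 1ℚ - u γ
    ½≤1-u = ≤-by-bernstein 1 ((1 , 0 , 2) ∷ []) (con ½) (con 1ℚ :- U) 0≤γ γ≤1 refl

    0≤r : 0ℚ ≤ r γ
    0≤r = ≤-by-bernstein 5 ((6 , 1 , 1) ∷ (1 , 2 , 0) ∷ []) (con 0ℚ) R 0≤γ γ≤1 refl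

    r≤1 : r γ ≤ 1ℚ
    r≤1 = ≤-by-bernstein 5 ((6 , 0 , 2) ∷ (6 , 1 , 1) ∷ (5 , 2 , 0) ∷ []) R (con 1ℚ) 0≤γ γ≤1 refl

    γu≤1 : γ * u γ ≤ 1ℚ
    γu≤1 = ≤-by-bernstein 1 ((2 , 0 , 3) ∷ (6 , 1 , 2) ∷ (4 , 2 , 1) ∷ (1 , 3 , 0) ∷ []) (γ̂ :* U) (con 1ℚ) 0≤γ γ≤1 refl

    -- The first factor bounds (3 - w) · e ^ w, by expPartial-tail with k = 2.
    upper-polynomial : ((3ℚ - w γ) * (1ℚ + w γ) + 3ℚ * (w γ * w γ * ½)) * (1ℚ + v γ - γ * v γ) ≤
                       (3ℚ - w γ) * ((1ℚ + v γ) * (1ℚ + v γ))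
    upper-polynomial = ≤-by-bernstein 1151
      ((576 , 2 , 5) ∷ (1536 , 3 , 4) ∷ (1412 , 4 , 3) ∷ (680 , 5 , 2) ∷ (363 , 6 , 1) ∷ (134 , 7 , 0) ∷ [])
      (((con 3ℚ :- W) :* (con 1ℚ :+ W) :+ con 3ℚ :* (W :* W :* con ½)) :* (con 1ℚ :+ V :- γ̂ :* V))
      ((con 3ℚ :- W) :* ((con 1ℚ :+ V) :* (con 1ℚ :+ V)))
      0≤γ γ≤1 refl

    -- 1 + r + r² / 2 = expPartial r 3.
    lower-polynomial : 1ℚ - γ * u γ ≤ (1ℚ + r γ + r γ * r γ * ½) * (1ℚ - u γ)
    lower-polynomial = ≤-by-bernstein 143
      ((24 , 2 , 4) ∷ (24 , 3 , 3) ∷ (74 , 4 , 2) ∷ (62 , 5 , 1) ∷ (13 , 6 , 0) ∷ [])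
      (con 1ℚ :- γ̂ :* U)
      ((con 1ℚ :+ R :+ R :* R :* con ½) :* (con 1ℚ :- U))
      0≤γ γ≤1 refl

  -- Chernoff bounds

  -- With γ = P / Q, A = 1 + a parts and y = z γ / A, chernoff-upper says e ^ (m y) · (1 + v / A) ^ m ≤ (1 + v) ^ k
  -- whenever k ≥ (1 + γ) m / A; (1 + v / A) ^ m is the expectation of (1 + v) ^ |S ∩ U_i| for |S| = m.
  module Chernoff {γ : ℚ} (0≤γ : 0ℚ ≤ γ) (γ≤1 : γ ≤ 1ℚ)
                  (a q P : ℕ) (Qγ≡P : ℕ→ℚ (suc q) * γ ≡ ℕ→ℚ P) (P≤Q : P ℕ.≤ suc q) where

    open ParameterBounds 0≤γ γ≤1

    Q : ℕ
    Q = suc q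

    A⁻¹ : ℚ
    A⁻¹ = 1/suc a

    y : ℚ
    y = z γ * A⁻¹

    0≤A⁻¹ : 0ℚ ≤ A⁻¹
    0≤A⁻¹ = 1/suc-nonNeg a

    0≤y : 0ℚ ≤ y
    0≤y = 0≤p*q 0≤z 0≤A⁻¹

    x*A⁻¹≤1 : ∀ {x} → 0ℚ ≤ x → x ≤ 1ℚ → x * A⁻¹ ≤ 1ℚ
    x*A⁻¹≤1 0≤x x≤1 = *-mono-≤-0≤ 0≤x 0≤A⁻¹ x≤1 (1/suc≤1 a)

    A*[x*A⁻¹]≡x : ∀ x → ℕ→ℚ (suc a) * (x * A⁻¹) ≡ x
    A*[x*A⁻¹]≡x x = begin
      ℕ→ℚ (suc a) * (x * A⁻¹)   ≡⟨ solve 3 (λ k x i → k :* (x :* i) := x :* (k :* i)) refl (ℕ→ℚ (suc a)) x A⁻¹ ⟩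
      x * (ℕ→ℚ (suc a) * A⁻¹)   ≡⟨ cong (x *_) (ℕ→ℚ*1/suc a) ⟩
      x * 1ℚ                    ≡⟨ *-identityʳ x ⟩
      x                         ∎
      where open ≡-Reasoning

    Q*[1+v-γv]≡[Q∸P]*[1+v]+P : ℕ→ℚ Q * (1ℚ + v γ - γ * v γ) ≡ ℕ→ℚ (Q ℕ.∸ P) * (1ℚ + v γ) + ℕ→ℚ P
    Q*[1+v-γv]≡[Q∸P]*[1+v]+P = begin
      ℕ→ℚ Q * (1ℚ + v γ - γ * v γ)                  ≡⟨ solve 3 (λ k g v → k :* (con 1ℚ :+ v :- g :* v) :=
                                                                     (k :- k :* g) :* (con 1ℚ :+ v) :+ k :* g) refl (ℕ→ℚ Q) γ (v γ) ⟩
      (ℕ→ℚ Q - ℕ→ℚ Q * γ) * (1ℚ + v γ) + ℕ→ℚ Q * γ  ≡⟨ cong (λ p → (ℕ→ℚ Q - p) * (1ℚ + v γ) + p) Qγ≡P ⟩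
      (ℕ→ℚ Q - ℕ→ℚ P) * (1ℚ + v γ) + ℕ→ℚ P          ≡⟨ cong (λ d → d * (1ℚ + v γ) + ℕ→ℚ P) (sym (ℕ→ℚ-homo-∸ P≤Q)) ⟩
      ℕ→ℚ (Q ℕ.∸ P) * (1ℚ + v γ) + ℕ→ℚ P            ∎
      where open ≡-Reasoning

    Q*[1-γu]≡P*[1-u]+[Q∸P] : ℕ→ℚ Q * (1ℚ - γ * u γ) ≡ ℕ→ℚ P * (1ℚ - u γ) + ℕ→ℚ (Q ℕ.∸ P)
    Q*[1-γu]≡P*[1-u]+[Q∸P] = begin
      ℕ→ℚ Q * (1ℚ - γ * u γ)                        ≡⟨ solve 3 (λ k g u → k :* (con 1ℚ :- g :* u) :=
                                                                     (k :* g) :* (con 1ℚ :- u) :+ (k :- k :* g)) refl (ℕ→ℚ Q) γ (u γ) ⟩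
      ℕ→ℚ Q * γ * (1ℚ - u γ) + (ℕ→ℚ Q - ℕ→ℚ Q * γ)  ≡⟨ cong (λ p → p * (1ℚ - u γ) + (ℕ→ℚ Q - p)) Qγ≡P ⟩
      ℕ→ℚ P * (1ℚ - u γ) + (ℕ→ℚ Q - ℕ→ℚ P)          ≡⟨ cong (ℕ→ℚ P * (1ℚ - u γ) +_) (sym (ℕ→ℚ-homo-∸ P≤Q)) ⟩
      ℕ→ℚ P * (1ℚ - u γ) + ℕ→ℚ (Q ℕ.∸ P)            ∎
      where open ≡-Reasoning

    1≤1+v : 1ℚ ≤ 1ℚ + v γ
    1≤1+v = p≤p+q 0≤v

    0<1+v : 0ℚ < 1ℚ + v γ
    0<1+v = <-≤-trans 0<1 1≤1+v

    0≤v/A : 0ℚ ≤ v γ * A⁻¹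
    0≤v/A = 0≤p*q 0≤v 0≤A⁻¹

    0<1+v/A : 0ℚ < 1ℚ + v γ * A⁻¹
    0<1+v/A = <-≤-trans 0<1 (p≤p+q 0≤v/A)

    0<1-u : 0ℚ < 1ℚ - u γ
    0<1-u = <-≤-trans (positive⁻¹ ½) ½≤1-u

    0<1-u/A : 0ℚ < 1ℚ - u γ * A⁻¹
    0<1-u/A = <-≤-trans 0<1-u (+-monoʳ-≤ 1ℚ (neg-antimono-≤ (≤-trans (*-monoˡ-≤-0≤ 0≤u (1/suc≤1 a)) (≤-reflexive (*-identityʳ (u γ))))))

    r/A : ℚ
    r/A = r γ * A⁻¹

    0≤r/A : 0ℚ ≤ r/A
    0≤r/A = 0≤p*q 0≤r 0≤A⁻¹

    0≤1-r/A : 0ℚ ≤ 1ℚ - r/A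
    0≤1-r/A = p≤q⇒0≤q-p (x*A⁻¹≤1 0≤r r≤1)

    upperFactor lowerFactor : ℕ → ℚ
    upperFactor n = expPartial y n * (1ℚ + v γ * A⁻¹)
    lowerFactor n = expPartial y n * (1ℚ - u γ * A⁻¹)

    upperFactor-nonNeg : ∀ n → 0ℚ ≤ upperFactor n
    upperFactor-nonNeg n = 0≤p*q (expPartial-nonNeg n 0≤y) (<⇒≤ 0<1+v/A)

    lowerFactor-nonNeg : ∀ n → 0ℚ ≤ lowerFactor n
    lowerFactor-nonNeg n = 0≤p*q (expPartial-nonNeg n 0≤y) (<⇒≤ 0<1-u/A)

    upperFactor≤expPartial : ∀ n → upperFactor n ≤ expPartial (w γ * A⁻¹) (n ℕ.+ 2)
    upperFactor≤expPartial n = begin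
      expPartial y n * (1ℚ + v γ * A⁻¹)             ≡⟨ cong (expPartial y n *_) (sym (expPartial-2 (v γ * A⁻¹))) ⟩
      expPartial y n * expPartial (v γ * A⁻¹) 2     ≤⟨ *-≤-expPartial-+ n 2 0≤y 0≤v/A ⟩
      expPartial (y + v γ * A⁻¹) (n ℕ.+ 2)          ≡⟨ cong (λ x → expPartial x (n ℕ.+ 2))
                                                          (solve 3 (λ z v i → z :* i :+ v :* i := (v :+ z) :* i) refl (z γ) (v γ) A⁻¹) ⟩
      expPartial (w γ * A⁻¹) (n ℕ.+ 2)              ∎
      where open ≤-Reasoning

    [3-w]*upperFactor^A≤ : ∀ n → (3ℚ - w γ) * upperFactor n ^ suc a ≤ (3ℚ - w γ) * (1ℚ + w γ) + 3ℚ * (w γ * w γ * ½)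
    [3-w]*upperFactor^A≤ n = begin
      (3ℚ - w γ) * upperFactor n ^ suc a                     ≤⟨ *-monoˡ-≤-0≤ 0≤3-w (begin
        upperFactor n ^ suc a                                   ≤⟨ ^-monoˡ-≤ (suc a) (upperFactor-nonNeg n) (upperFactor≤expPartial n) ⟩
        expPartial (w γ * A⁻¹) (n ℕ.+ 2) ^ suc a                 ≤⟨ proj₂ power≤expPartial ⟩
        expPartial (ℕ→ℚ (suc a) * (w γ * A⁻¹)) M                 ≡⟨ cong (λ x → expPartial x M) (A*[x*A⁻¹]≡x (w γ)) ⟩
        expPartial (w γ) M                                       ∎) ⟩
      (3ℚ - w γ) * expPartial (w γ) M                        ≤⟨ expPartial-tail 2 M 0≤w (0≤q-p⇒p≤q 0≤3-w) ⟩
      (3ℚ - w γ) * expPartial (w γ) 2 + 3ℚ * expTerm (w γ) 2 ≡⟨ cong₂ (λ s e → (3ℚ - w γ) * s + 3ℚ * e) (expPartial-2 (w γ)) (expTerm-2 (w γ)) ⟩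
      (3ℚ - w γ) * (1ℚ + w γ) + 3ℚ * (w γ * w γ * ½)         ∎
      where
      open ≤-Reasoning
      0≤w = 0≤p+q 0≤v 0≤z
      0≤3-w = ≤-trans 0≤1 1≤3-w
      power≤expPartial = ^-≤-expPartial-ℕ* (suc a) (n ℕ.+ 2) (0≤p*q 0≤w 0≤A⁻¹)
      M = proj₁ power≤expPartial

    upperFactor^A*[1+v-γv]≤[1+v]² : ∀ n → upperFactor n ^ suc a * (1ℚ + v γ - γ * v γ) ≤ (1ℚ + v γ) ^ 2
    upperFactor^A*[1+v-γv]≤[1+v]² n = *-cancelˡ-≤-0< (<-≤-trans 0<1 1≤3-w) (begin
      (3ℚ - w γ) * (G * c)                                 ≡⟨ sym (*-assoc (3ℚ - w γ) G c) ⟩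
      ((3ℚ - w γ) * G) * c                                 ≤⟨ *-monoʳ-≤-0≤ (≤-trans 0≤1 1≤1+v-γv) ([3-w]*upperFactor^A≤ n) ⟩
      ((3ℚ - w γ) * (1ℚ + w γ) + 3ℚ * (w γ * w γ * ½)) * c ≤⟨ upper-polynomial ⟩
      (3ℚ - w γ) * (t * t)                                 ≡⟨ cong (λ x → (3ℚ - w γ) * (t * x)) (sym (*-identityʳ t)) ⟩
      (3ℚ - w γ) * t ^ 2                                   ∎)
      where
      open ≤-Reasoning
      G = upperFactor n ^ suc a
      c = 1ℚ + v γ - γ * v γ
      t = 1ℚ + v γ

    upper-block-bound : ∀ n → (upperFactor n ^ suc a) ^ Q ≤ (1ℚ + v γ) ^ (P ℕ.+ Q)
    upper-block-bound n =
      g*c≤t^s⇒t^e≤c^Q⇒g^Q≤t^f Q 2 (Q ℕ.∸ P) (P ℕ.+ Q) (^-nonNeg (suc a) (upperFactor-nonNeg n)) (≤-trans 0≤1 1≤1+v-γv)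
        0<1+v (upperFactor^A*[1+v-γv]≤[1+v]² n)
        (amgm-ones q (Q ℕ.∸ P) P (≤-trans 0≤1 1≤1+v) (ℕ.m∸n+n≡m P≤Q) Q*[1+v-γv]≡[Q∸P]*[1+v]+P)
        exponents
      where
      open ≡-Reasoning
      exponents : (Q ℕ.∸ P) ℕ.+ (P ℕ.+ Q) ≡ 2 ℕ.* Q
      exponents = begin
        (Q ℕ.∸ P) ℕ.+ (P ℕ.+ Q)  ≡⟨ sym (ℕ.+-assoc (Q ℕ.∸ P) P Q) ⟩
        (Q ℕ.∸ P) ℕ.+ P ℕ.+ Q    ≡⟨ cong (ℕ._+ Q) (ℕ.m∸n+n≡m P≤Q) ⟩
        Q ℕ.+ Q                  ≡⟨ cong (Q ℕ.+_) (sym (ℕ.+-identityʳ Q)) ⟩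
        2 ℕ.* Q                  ∎

    lowerFactor≤1-r/A : ∀ n → lowerFactor n ≤ 1ℚ - r/A
    lowerFactor≤1-r/A n = begin
      expPartial y n * (1ℚ - u γ * A⁻¹)        ≤⟨ *-monoˡ-≤-0≤ (expPartial-nonNeg n 0≤y) 1-u/A≤[1-y][1-r/A] ⟩
      expPartial y n * ((1ℚ - y) * (1ℚ - r/A)) ≡⟨ solve 3 (λ s a b → s :* (a :* b) := (a :* s) :* b) refl (expPartial y n) (1ℚ - y) (1ℚ - r/A) ⟩
      ((1ℚ - y) * expPartial y n) * (1ℚ - r/A) ≤⟨ *-monoʳ-≤-0≤ 0≤1-r/A (expPartial-geometric n 0≤y (x*A⁻¹≤1 0≤z z≤1)) ⟩
      1ℚ * (1ℚ - r/A)                          ≡⟨ *-identityˡ (1ℚ - r/A) ⟩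
      1ℚ - r/A                                 ∎
      where
      open ≤-Reasoning
      1-u/A≤[1-y][1-r/A] : 1ℚ - u γ * A⁻¹ ≤ (1ℚ - y) * (1ℚ - r/A)
      1-u/A≤[1-y][1-r/A] = 0≤q-p⇒p≤q (subst (0ℚ ≤_)
        (solve 3 (λ u z i → (z :* i) :* ((u :- z) :* i) := (con 1ℚ :- z :* i) :* (con 1ℚ :- (u :- z) :* i) :- (con 1ℚ :- u :* i))
           refl (u γ) (z γ) A⁻¹)
        (0≤p*q 0≤y 0≤r/A))

    lowerFactor^A*expPartial[r,3]≤1 : ∀ n → lowerFactor n ^ suc a * expPartial (r γ) 3 ≤ 1ℚ
    lowerFactor^A*expPartial[r,3]≤1 n = begin
      G * expPartial (r γ) 3                                  ≡⟨ cong (λ x → G * expPartial x 3) (sym (A*[x*A⁻¹]≡x (r γ))) ⟩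
      G * expPartial (ℕ→ℚ (suc a) * r/A) 3                    ≤⟨ *-mono-≤-0≤ (^-nonNeg (suc a) (lowerFactor-nonNeg n))
                                                                   (expPartial-nonNeg 3 (0≤p*q (ℕ→ℚ-nonNeg (suc a)) 0≤r/A))
                                                                   (^-monoˡ-≤ (suc a) (lowerFactor-nonNeg n) (lowerFactor≤1-r/A n))
                                                                   (expPartial-ℕ*-≤-^ (suc a) 3 0≤r/A) ⟩
      (1ℚ - r/A) ^ suc a * expPartial r/A 3 ^ suc a           ≡⟨ sym (^-distrib-* (1ℚ - r/A) (expPartial r/A 3) (suc a)) ⟩
      ((1ℚ - r/A) * expPartial r/A 3) ^ suc a                 ≤⟨ x^n≤1 (suc a) (0≤p*q 0≤1-r/A (expPartial-nonNeg 3 0≤r/A))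
                                                                   (expPartial-geometric 3 0≤r/A (x*A⁻¹≤1 0≤r r≤1)) ⟩
      1ℚ                                                      ∎
      where
      open ≤-Reasoning
      G = lowerFactor n ^ suc a

    lowerFactor^A*[1-γu]≤1-u : ∀ n → lowerFactor n ^ suc a * (1ℚ - γ * u γ) ≤ (1ℚ - u γ) ^ 1
    lowerFactor^A*[1-γu]≤1-u n = begin
      G * (1ℚ - γ * u γ)                            ≤⟨ *-monoˡ-≤-0≤ (^-nonNeg (suc a) (lowerFactor-nonNeg n)) lower-polynomial ⟩
      G * ((1ℚ + r γ + r γ * r γ * ½) * t)          ≡⟨ cong (λ s → G * (s * t)) (sym (expPartial-3 (r γ))) ⟩
      G * (expPartial (r γ) 3 * t)                  ≡⟨ sym (*-assoc G (expPartial (r γ) 3) t) ⟩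
      (G * expPartial (r γ) 3) * t                  ≤⟨ *-monoʳ-≤-0≤ (<⇒≤ 0<1-u) (lowerFactor^A*expPartial[r,3]≤1 n) ⟩
      1ℚ * t                                        ≡⟨ *-comm 1ℚ t ⟩
      t ^ 1                                         ∎
      where
      open ≤-Reasoning
      G = lowerFactor n ^ suc a
      t = 1ℚ - u γ

    lower-block-bound : ∀ n → (lowerFactor n ^ suc a) ^ Q ≤ (1ℚ - u γ) ^ (Q ℕ.∸ P)
    lower-block-bound n =
      g*c≤t^s⇒t^e≤c^Q⇒g^Q≤t^f Q 1 P (Q ℕ.∸ P) (^-nonNeg (suc a) (lowerFactor-nonNeg n)) (p≤q⇒0≤q-p γu≤1) 0<1-u
        (lowerFactor^A*[1-γu]≤1-u n)
        (amgm-ones q P (Q ℕ.∸ P) (<⇒≤ 0<1-u) (ℕ.m+[n∸m]≡n P≤Q) Q*[1-γu]≡P*[1-u]+[Q∸P])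
        (trans (ℕ.m+[n∸m]≡n P≤Q) (sym (ℕ.*-identityˡ Q)))

    chernoff-upper : ∀ m n k → (P ℕ.+ Q) ℕ.* m ℕ.≤ suc a ℕ.* Q ℕ.* k →
                     expPartial (ℕ→ℚ m * y) n * (1ℚ + v γ * A⁻¹) ^ m ≤ (1ℚ + v γ) ^ k
    chernoff-upper m n k [P+Q]m≤AQk = begin
      expPartial (ℕ→ℚ m * y) n * s ^ m  ≤⟨ *-monoʳ-≤-0≤ (^-nonNeg m (<⇒≤ 0<1+v/A)) (expPartial-ℕ*-≤-^ m n 0≤y) ⟩
      expPartial y n ^ m * s ^ m        ≡⟨ sym (^-distrib-* (expPartial y n) s m) ⟩
      upperFactor n ^ m                 ≤⟨ ^-root-≤ (q ℕ.+ a ℕ.* Q) (P ℕ.+ Q) m k (upperFactor-nonNeg n) (≤-trans 0≤1 1≤1+v)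
                                             (≤-trans (≤-reflexive (sym (^-assocʳ (upperFactor n) (suc a) Q))) (upper-block-bound n))
                                             (^-monoʳ-≤ 1≤1+v [P+Q]m≤AQk) ⟩
      (1ℚ + v γ) ^ k                    ∎
      where
      open ≤-Reasoning
      s = 1ℚ + v γ * A⁻¹

    chernoff-lower : ∀ m n k → suc a ℕ.* Q ℕ.* k ℕ.≤ (Q ℕ.∸ P) ℕ.* m →
                     expPartial (ℕ→ℚ m * y) n * (1ℚ - u γ * A⁻¹) ^ m ≤ (1ℚ - u γ) ^ k
    chernoff-lower m n k AQk≤[Q∸P]m = begin
      expPartial (ℕ→ℚ m * y) n * s ^ m  ≤⟨ *-monoʳ-≤-0≤ (^-nonNeg m (<⇒≤ 0<1-u/A)) (expPartial-ℕ*-≤-^ m n 0≤y) ⟩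
      expPartial y n ^ m * s ^ m        ≡⟨ sym (^-distrib-* (expPartial y n) s m) ⟩
      lowerFactor n ^ m                 ≤⟨ ^-root-≤ (q ℕ.+ a ℕ.* Q) (Q ℕ.∸ P) m k (lowerFactor-nonNeg n) (<⇒≤ 0<1-u)
                                             (≤-trans (≤-reflexive (sym (^-assocʳ (lowerFactor n) (suc a) Q))) (lower-block-bound n))
                                             (^-antimonoʳ-≤ (<⇒≤ 0<1-u) (p-q≤p 0≤u) AQk≤[Q∸P]m) ⟩
      (1ℚ - u γ) ^ k                    ∎
      where
      open ≤-Reasoning
      s = 1ℚ - u γ * A⁻¹

  -- Averages over random maps

  sum-const : ∀ n c → ∑[ i < n ] c ≡ ℕ→ℚ n * c
  sum-const zero    c = sym (*-zeroˡ c)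
  sum-const (suc n) c = begin
    c + ∑[ i < n ] c    ≡⟨ cong (c +_) (sum-const n c) ⟩
    c + ℕ→ℚ n * c       ≡⟨ sym (ℕ→ℚ-suc-* n c) ⟩
    ℕ→ℚ (suc n) * c     ∎
    where open ≡-Reasoning

  sum-nonNeg : ∀ {n} {f : Fin n → ℚ} → (∀ i → 0ℚ ≤ f i) → 0ℚ ≤ sum f
  sum-nonNeg {zero}  0≤f = ≤-refl
  sum-nonNeg {suc n} 0≤f = 0≤p+q (0≤f zero) (sum-nonNeg (λ i → 0≤f (suc i)))

  term≤sum : ∀ {n} {f : Fin n → ℚ} → (∀ i → 0ℚ ≤ f i) → ∀ i → f i ≤ sum f
  term≤sum {suc n} {f} 0≤f zero    = p≤p+q (sum-nonNeg (λ i → 0≤f (suc i)))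
  term≤sum {suc n} {f} 0≤f (suc i) = ≤-trans (term≤sum (λ i → 0≤f (suc i)) i) (p≤q+p (0≤f zero))

  sum-mono-≤ : ∀ {n} {f g : Fin n → ℚ} → (∀ i → f i ≤ g i) → sum f ≤ sum g
  sum-mono-≤ {zero}  f≤g = ≤-refl
  sum-mono-≤ {suc n} f≤g = +-mono-≤ (f≤g zero) (sum-mono-≤ (λ i → f≤g (suc i)))

  sum-mono-< : ∀ {n} {f g : Fin (suc n) → ℚ} → (∀ i → f i < g i) → sum f < sum g
  sum-mono-< f<g = +-mono-<-≤ (f<g zero) (sum-mono-≤ (λ i → <⇒≤ (f<g (suc i))))

  *-sum-< : ∀ {n} K c (h : Fin (suc n) → ℚ) → (∀ j → K * h j < c) → K * sum h < ℕ→ℚ (suc n) * c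
  *-sum-< {n} K c h Kh<c = begin-strict
    K * sum h                       ≡⟨ *-distribˡ-sum K h ⟩
    ∑[ j < suc n ] (K * h j)        <⟨ sum-mono-< Kh<c ⟩
    ∑[ j < suc n ] c                ≡⟨ sum-const (suc n) c ⟩
    ℕ→ℚ (suc n) * c                 ∎
    where open ≤-Reasoning

  sum<⇒∃< : ∀ {n} (f : Fin n → ℚ) c → sum f < ℕ→ℚ n * c → Σ (Fin n) λ i → f i < c
  sum<⇒∃< {zero}  f c ∑f<0 = ⊥-elim (<-irrefl (sym (*-zeroˡ c)) ∑f<0)
  sum<⇒∃< {suc n} f c ∑f<[1+n]c with f zero <? c | sum (λ i → f (suc i)) <? ℕ→ℚ n * c
  ... | yes f₀<c | _        = zero , f₀<c
  ... | no _     | yes ∑f′<nc = let i , fᵢ<c = sum<⇒∃< (λ i → f (suc i)) c ∑f′<nc in suc i , fᵢ<c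
  ... | no f₀≮c  | no ∑f′≮nc = ⊥-elim (<-irrefl refl (<-≤-trans ∑f<[1+n]c (begin
    ℕ→ℚ (suc n) * c                      ≡⟨ ℕ→ℚ-suc-* n c ⟩
    c + ℕ→ℚ n * c                        ≤⟨ +-mono-≤ (≮⇒≥ f₀≮c) (≮⇒≥ ∑f′≮nc) ⟩
    f zero + sum (λ i → f (suc i))       ∎)))
    where open ≤-Reasoning

  -- The expectation over a uniformly random map Fin n → Fin (1 + a).
  average : ∀ a n → ((Fin n → Fin (suc a)) → ℚ) → ℚ
  average a zero    g = g (λ ())
  average a (suc n) g = 1/suc a * ∑[ j < suc a ] average a n (λ p → g (j ◃ p))

  average-cong : ∀ a n {g h : (Fin n → Fin (suc a)) → ℚ} → (∀ p → g p ≡ h p) → average a n g ≡ average a n h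
  average-cong a zero    g≗h = g≗h (λ ())
  average-cong a (suc n) g≗h = cong (1/suc a *_) (sum-cong-≗ (λ j → average-cong a n (λ p → g≗h (j ◃ p))))

  average-distrib-+ : ∀ a n (g h : (Fin n → Fin (suc a)) → ℚ) →
                      average a n (λ p → g p + h p) ≡ average a n g + average a n h
  average-distrib-+ a zero    g h = refl
  average-distrib-+ a (suc n) g h = begin
    1/suc a * ∑[ j < suc a ] average a n (λ p → g (j ◃ p) + h (j ◃ p))
      ≡⟨ cong (1/suc a *_) (sum-cong-≗ (λ j → average-distrib-+ a n (λ p → g (j ◃ p)) (λ p → h (j ◃ p)))) ⟩
    1/suc a * ∑[ j < suc a ] (G j + H j)
      ≡⟨ cong (1/suc a *_) (∑-distrib-+ G H) ⟩
    1/suc a * (∑[ j < suc a ] G j + ∑[ j < suc a ] H j)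
      ≡⟨ *-distribˡ-+ (1/suc a) (∑[ j < suc a ] G j) (∑[ j < suc a ] H j) ⟩
    average a (suc n) g + average a (suc n) h ∎
    where
    open ≡-Reasoning
    G = λ j → average a n (λ p → g (j ◃ p))
    H = λ j → average a n (λ p → h (j ◃ p))

  average-* : ∀ a n c (g : (Fin n → Fin (suc a)) → ℚ) → average a n (λ p → c * g p) ≡ c * average a n g
  average-* a zero    c g = refl
  average-* a (suc n) c g = begin
    1/suc a * ∑[ j < suc a ] average a n (λ p → c * g (j ◃ p))
      ≡⟨ cong (1/suc a *_) (sum-cong-≗ (λ j → average-* a n c (λ p → g (j ◃ p)))) ⟩
    1/suc a * ∑[ j < suc a ] (c * G j)
      ≡⟨ cong (1/suc a *_) (sym (*-distribˡ-sum c G)) ⟩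
    1/suc a * (c * ∑[ j < suc a ] G j)
      ≡⟨ solve 3 (λ r c s → r :* (c :* s) := c :* (r :* s)) refl (1/suc a) c (∑[ j < suc a ] G j) ⟩
    c * average a (suc n) g ∎
    where
    open ≡-Reasoning
    G = λ j → average a n (λ p → g (j ◃ p))

  average-const : ∀ a n c → average a n (λ _ → c) ≡ c
  average-const a zero    c = refl
  average-const a (suc n) c = begin
    1/suc a * ∑[ j < suc a ] average a n (λ _ → c)  ≡⟨ cong (1/suc a *_) (sum-cong-≗ {suc a} {λ _ → average a n (λ _ → c)} {λ _ → c}
                                                                                (λ j → average-const a n c)) ⟩
    1/suc a * ∑[ j < suc a ] c                      ≡⟨ cong (1/suc a *_) (sum-const (suc a) c) ⟩
    1/suc a * (ℕ→ℚ (suc a) * c)                     ≡⟨ solve 3 (λ r k c → r :* (k :* c) := (k :* r) :* c) refl (1/suc a) (ℕ→ℚ (suc a)) c ⟩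
    (ℕ→ℚ (suc a) * 1/suc a) * c                     ≡⟨ cong (_* c) (ℕ→ℚ*1/suc a) ⟩
    1ℚ * c                                          ≡⟨ *-identityˡ c ⟩
    c                                               ∎
    where open ≡-Reasoning

  average-sum : ∀ a n k (h : Fin k → (Fin n → Fin (suc a)) → ℚ) →
                average a n (λ p → ∑[ j < k ] h j p) ≡ ∑[ j < k ] average a n (h j)
  average-sum a n zero    h = average-const a n 0ℚ
  average-sum a n (suc k) h = trans (average-distrib-+ a n (h zero) (λ p → ∑[ j < k ] h (suc j) p))
                                    (cong (average a n (h zero) +_) (average-sum a n k (λ j → h (suc j))))

  average<⇒∃< : ∀ a n (g : (Fin n → Fin (suc a)) → ℚ) c → average a n g < c → Σ (Fin n → Fin (suc a)) λ p → g p < c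
  average<⇒∃< a zero    g c avg<c = (λ ()) , avg<c
  average<⇒∃< a (suc n) g c avg<c =
    let j , Gⱼ<c = sum<⇒∃< G c ∑G<[1+a]c
        p , g[j◃p]<c = average<⇒∃< a n (λ p → g (j ◃ p)) c Gⱼ<c
    in (j ◃ p) , g[j◃p]<c
    where
    G = λ j → average a n (λ p → g (j ◃ p))
    ∑G<[1+a]c : sum G < ℕ→ℚ (suc a) * c
    ∑G<[1+a]c = begin-strict
      sum G                                ≡⟨ sym (*-identityˡ (sum G)) ⟩
      1ℚ * sum G                           ≡⟨ cong (_* sum G) (sym (ℕ→ℚ*1/suc a)) ⟩
      (ℕ→ℚ (suc a) * 1/suc a) * sum G      ≡⟨ *-assoc (ℕ→ℚ (suc a)) (1/suc a) (sum G) ⟩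
      ℕ→ℚ (suc a) * (1/suc a * sum G)      <⟨ *-monoˡ-<-0< (ℕ→ℚ-pos a) avg<c ⟩
      ℕ→ℚ (suc a) * c                      ∎
      where open ≤-Reasoning

  sum-if-≟ : ∀ a t (i : Fin (suc a)) → ∑[ j < suc a ] (if does (j Fin.≟ i) then t else 1ℚ) ≡ t + ℕ→ℚ a
  sum-if-≟ a       t zero    = cong (t +_) (trans (sum-const a 1ℚ) (*-identityʳ (ℕ→ℚ a)))
  sum-if-≟ (suc a) t (suc i) = begin
    1ℚ + ∑[ j < suc a ] (if does (j Fin.≟ i) then t else 1ℚ)  ≡⟨ cong (1ℚ +_) (sum-if-≟ a t i) ⟩
    1ℚ + (t + ℕ→ℚ a)                                          ≡⟨ solve 2 (λ t k → con 1ℚ :+ (t :+ k) := t :+ (con 1ℚ :+ k)) refl t (ℕ→ℚ a) ⟩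
    t + (1ℚ + ℕ→ℚ a)                                          ≡⟨ cong (t +_) (sym (ℕ→ℚ-suc a)) ⟩
    t + ℕ→ℚ (suc a)                                           ∎
    where open ≡-Reasoning

  ^-∣∩block∣-∷ : ∀ {n a} t (S : Subset n) (j i : Fin (suc a)) (p : Fin n → Fin (suc a)) →
                 t ^ ∣ (true ∷ S) ∩ block (j ◃ p) i ∣ ≡ (if does (j Fin.≟ i) then t else 1ℚ) * t ^ ∣ S ∩ block p i ∣
  ^-∣∩block∣-∷ t S j i p with j Fin.≟ i
  ... | yes _ = refl
  ... | no _  = sym (*-identityˡ (t ^ ∣ S ∩ block p i ∣))

  average-^-∣∩block∣ : ∀ a n (S : Subset n) (i : Fin (suc a)) t →
                       average a n (λ p → t ^ ∣ S ∩ block p i ∣) ≡ ((t + ℕ→ℚ a) * 1/suc a) ^ ∣ S ∣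
  average-^-∣∩block∣ a zero    []          i t = refl
  average-^-∣∩block∣ a (suc n) (false ∷ S) i t = begin
    1/suc a * ∑[ j < suc a ] E                 ≡⟨ cong (1/suc a *_) (sum-const (suc a) E) ⟩
    1/suc a * (ℕ→ℚ (suc a) * E)                ≡⟨ solve 3 (λ r k e → r :* (k :* e) := (k :* r) :* e) refl (1/suc a) (ℕ→ℚ (suc a)) E ⟩
    (ℕ→ℚ (suc a) * 1/suc a) * E                ≡⟨ cong (_* E) (ℕ→ℚ*1/suc a) ⟩
    1ℚ * E                                     ≡⟨ *-identityˡ E ⟩
    E                                          ≡⟨ average-^-∣∩block∣ a n S i t ⟩
    ((t + ℕ→ℚ a) * 1/suc a) ^ ∣ S ∣            ∎
    where
    open ≡-Reasoning
    E = average a n (λ p → t ^ ∣ S ∩ block p i ∣)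
  average-^-∣∩block∣ a (suc n) (true ∷ S) i t = begin
    1/suc a * ∑[ j < suc a ] average a n (λ p → t ^ ∣ (true ∷ S) ∩ block (j ◃ p) i ∣)
      ≡⟨ cong (1/suc a *_) (sum-cong-≗ (λ j → trans (average-cong a n (^-∣∩block∣-∷ t S j i))
                                                     (average-* a n (weight j) (λ p → t ^ ∣ S ∩ block p i ∣)))) ⟩
    1/suc a * ∑[ j < suc a ] (weight j * E)
      ≡⟨ cong (1/suc a *_) (sym (*-distribʳ-sum E weight)) ⟩
    1/suc a * (∑[ j < suc a ] weight j * E)
      ≡⟨ cong (λ s → 1/suc a * (s * E)) (sum-if-≟ a t i) ⟩
    1/suc a * ((t + ℕ→ℚ a) * E)
      ≡⟨ solve 3 (λ r s e → r :* (s :* e) := (s :* r) :* e) refl (1/suc a) (t + ℕ→ℚ a) E ⟩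
    ((t + ℕ→ℚ a) * 1/suc a) * E
      ≡⟨ cong (((t + ℕ→ℚ a) * 1/suc a) *_) (average-^-∣∩block∣ a n S i t) ⟩
    ((t + ℕ→ℚ a) * 1/suc a) ^ ∣ true ∷ S ∣ ∎
    where
    open ≡-Reasoning
    weight = λ (j : Fin (suc a)) → if does (j Fin.≟ i) then t else 1ℚ
    E = average a n (λ p → t ^ ∣ S ∩ block p i ∣)

  -- Markov's inequality for the block intersections

  m<[1+m/n]*n : ∀ m n .{{_ : ℕ.NonZero n}} → m ℕ.< suc (m ℕ./ n) ℕ.* n
  m<[1+m/n]*n m n = begin-strict
    m                           ≡⟨ ℕ.m≡m%n+[m/n]*n m n ⟩
    m ℕ.% n ℕ.+ (m ℕ./ n) ℕ.* n <⟨ ℕ.+-monoˡ-< ((m ℕ./ n) ℕ.* n) (ℕ.m%n<n m n) ⟩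
    n ℕ.+ (m ℕ./ n) ℕ.* n         ∎
    where open ℕ.≤-Reasoning

  m*n≤o⇒m≤o/n : ∀ m n o .{{_ : ℕ.NonZero n}} → m ℕ.* n ℕ.≤ o → m ℕ.≤ o ℕ./ n
  m*n≤o⇒m≤o/n m n o mn≤o = subst (ℕ._≤ o ℕ./ n) (ℕ.m*n/n≡m m n) (ℕ./-monoˡ-≤ n mn≤o)

  markovWeight : ∀ {t} → 0ℚ < t → ℕ → ℕ → ℚ
  markovWeight {t} 0<t k x = t ^ x * (1/ (t ^ k)) {{>-nonZero (^-pos k 0<t)}}

  markovWeight-nonNeg : ∀ {t} (0<t : 0ℚ < t) k x → 0ℚ ≤ markovWeight 0<t k x
  markovWeight-nonNeg {t} 0<t k x =
    0≤p*q (^-nonNeg x (<⇒≤ 0<t)) (<⇒≤ (positive⁻¹ _ {{1/pos⇒pos (t ^ k) {{positive (^-pos k 0<t)}}}}))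

  tᵏ≤tˣ⇒1≤markovWeight : ∀ {t} (0<t : 0ℚ < t) k x → t ^ k ≤ t ^ x → 1ℚ ≤ markovWeight 0<t k x
  tᵏ≤tˣ⇒1≤markovWeight {t} 0<t k x tᵏ≤tˣ = begin
    1ℚ                                               ≡⟨ sym (*-inverseʳ (t ^ k) {{>-nonZero (^-pos k 0<t)}}) ⟩
    t ^ k * (1/ (t ^ k)) {{>-nonZero (^-pos k 0<t)}} ≤⟨ *-monoʳ-≤-0≤ (<⇒≤ (positive⁻¹ _ {{1/pos⇒pos (t ^ k) {{positive (^-pos k 0<t)}}}})) tᵏ≤tˣ ⟩
    markovWeight 0<t k x                             ∎
    where open ≤-Reasoning

  markov-bound : ∀ a n (S : Subset n) i {t} (0<t : 0ℚ < t) k K →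
                 K * ((t + ℕ→ℚ a) * 1/suc a) ^ ∣ S ∣ < t ^ k →
                 K * average a n (λ p → markovWeight 0<t k ∣ S ∩ block p i ∣) < 1ℚ
  markov-bound a n S i {t} 0<t k K K*E<tᵏ = begin-strict
    K * average a n (λ p → t ^ ∣ S ∩ block p i ∣ * ρ)  ≡⟨ cong (K *_) (average-cong a n (λ p → *-comm (t ^ ∣ S ∩ block p i ∣) ρ)) ⟩
    K * average a n (λ p → ρ * t ^ ∣ S ∩ block p i ∣)  ≡⟨ cong (K *_) (average-* a n ρ (λ p → t ^ ∣ S ∩ block p i ∣)) ⟩
    K * (ρ * average a n (λ p → t ^ ∣ S ∩ block p i ∣)) ≡⟨ cong (λ e → K * (ρ * e)) (average-^-∣∩block∣ a n S i t) ⟩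
    K * (ρ * E)                                         ≡⟨ solve 3 (λ k r e → k :* (r :* e) := (k :* e) :* r) refl K ρ E ⟩
    (K * E) * ρ                                         <⟨ *-monoʳ-<-0< 0<ρ K*E<tᵏ ⟩
    t ^ k * ρ                                           ≡⟨ *-inverseʳ (t ^ k) {{>-nonZero (^-pos k 0<t)}} ⟩
    1ℚ                                                  ∎
    where
    open ≤-Reasoning
    ρ = (1/ (t ^ k)) {{>-nonZero (^-pos k 0<t)}}
    0<ρ = positive⁻¹ ρ {{1/pos⇒pos (t ^ k) {{positive (^-pos k 0<t)}}}}
    E = ((t + ℕ→ℚ a) * 1/suc a) ^ ∣ S ∣

  -- upperThreshold m is the least k with k > (1 + γ) m / A and lowerThreshold m the largest k with
  -- k ≤ (1 - γ) m / A, so the weights t ^ X / t ^ k are at least 1 on the corresponding bad events.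
  module TailWeights {γ : ℚ} (0≤γ : 0ℚ ≤ γ) (γ≤1 : γ ≤ 1ℚ)
                     (a q P : ℕ) (Qγ≡P : ℕ→ℚ (suc q) * γ ≡ ℕ→ℚ P) (P≤Q : P ℕ.≤ suc q) where

    open ParameterBounds 0≤γ γ≤1
    open Chernoff 0≤γ γ≤1 a q P Qγ≡P P≤Q

    AQ : ℕ
    AQ = suc a ℕ.* Q

    upperThreshold lowerThreshold : ℕ → ℕ
    upperThreshold m = suc ((P ℕ.+ Q) ℕ.* m ℕ./ AQ)
    lowerThreshold m = (Q ℕ.∸ P) ℕ.* m ℕ./ AQ

    upperWeight lowerWeight : ∀ {n} → Subset n → Fin (suc a) → (Fin n → Fin (suc a)) → ℚ
    upperWeight S i p = markovWeight 0<1+v (upperThreshold ∣ S ∣) ∣ S ∩ block p i ∣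
    lowerWeight S i p = markovWeight 0<1-u (lowerThreshold ∣ S ∣) ∣ S ∩ block p i ∣

    1≤upperWeight : ∀ {n} (S : Subset n) i p → (P ℕ.+ Q) ℕ.* ∣ S ∣ ℕ.< AQ ℕ.* ∣ S ∩ block p i ∣ → 1ℚ ≤ upperWeight S i p
    1≤upperWeight S i p too-many = tᵏ≤tˣ⇒1≤markovWeight 0<1+v (upperThreshold ∣ S ∣) X (^-monoʳ-≤ 1≤1+v k≤X)
      where
      X = ∣ S ∩ block p i ∣
      k≤X : upperThreshold ∣ S ∣ ℕ.≤ X
      k≤X = ℕ.m<n*o⇒m/o<n {n = X} {o = AQ} (subst ((P ℕ.+ Q) ℕ.* ∣ S ∣ ℕ.<_) (ℕ.*-comm AQ X) too-many)

    1≤lowerWeight : ∀ {n} (S : Subset n) i p → AQ ℕ.* ∣ S ∩ block p i ∣ ℕ.< (Q ℕ.∸ P) ℕ.* ∣ S ∣ → 1ℚ ≤ lowerWeight S i p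
    1≤lowerWeight S i p too-few = tᵏ≤tˣ⇒1≤markovWeight 0<1-u (lowerThreshold ∣ S ∣) X (^-antimonoʳ-≤ (<⇒≤ 0<1-u) (p-q≤p 0≤u) X≤k)
      where
      X = ∣ S ∩ block p i ∣
      X≤k : X ℕ.≤ lowerThreshold ∣ S ∣
      X≤k = m*n≤o⇒m≤o/n X AQ ((Q ℕ.∸ P) ℕ.* ∣ S ∣) (subst (ℕ._≤ (Q ℕ.∸ P) ℕ.* ∣ S ∣) (ℕ.*-comm AQ X) (ℕ.<⇒≤ too-few))

    upperWeight-bound : ∀ {K n} (S : Subset n) → K <exp (ℕ→ℚ ∣ S ∣ * y) → ∀ i → K * average a n (upperWeight S i) < 1ℚ
    upperWeight-bound {K} {n} S (N , K<e) i = markov-bound a n S i 0<1+v k K (begin-strict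
      K * ((1ℚ + v γ + ℕ→ℚ a) * A⁻¹) ^ m        ≡⟨ cong (λ s → K * s ^ m) mean-tilt ⟩
      K * (1ℚ + v γ * A⁻¹) ^ m                  <⟨ *-monoʳ-<-0< (^-pos m 0<1+v/A) K<e ⟩
      expPartial (ℕ→ℚ m * y) N * (1ℚ + v γ * A⁻¹) ^ m ≤⟨ chernoff-upper m N k (ℕ.<⇒≤ (subst ((P ℕ.+ Q) ℕ.* m ℕ.<_) (ℕ.*-comm _ AQ) (m<[1+m/n]*n _ AQ))) ⟩
      (1ℚ + v γ) ^ k                            ∎)
      where
      open ≤-Reasoning
      m = ∣ S ∣
      k = upperThreshold m
      mean-tilt : (1ℚ + v γ + ℕ→ℚ a) * A⁻¹ ≡ 1ℚ + v γ * A⁻¹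
      mean-tilt = begin-equality
        (1ℚ + v γ + ℕ→ℚ a) * A⁻¹         ≡⟨ solve 3 (λ v k i → (con 1ℚ :+ v :+ k) :* i := v :* i :+ (con 1ℚ :+ k) :* i) refl (v γ) (ℕ→ℚ a) A⁻¹ ⟩
        v γ * A⁻¹ + (1ℚ + ℕ→ℚ a) * A⁻¹   ≡⟨ cong (λ s → v γ * A⁻¹ + s * A⁻¹) (sym (ℕ→ℚ-suc a)) ⟩
        v γ * A⁻¹ + ℕ→ℚ (suc a) * A⁻¹    ≡⟨ cong (v γ * A⁻¹ +_) (ℕ→ℚ*1/suc a) ⟩
        v γ * A⁻¹ + 1ℚ                   ≡⟨ +-comm (v γ * A⁻¹) 1ℚ ⟩
        1ℚ + v γ * A⁻¹                   ∎

    lowerWeight-bound : ∀ {K n} (S : Subset n) → K <exp (ℕ→ℚ ∣ S ∣ * y) → ∀ i → K * average a n (lowerWeight S i) < 1ℚ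
    lowerWeight-bound {K} {n} S (N , K<e) i = markov-bound a n S i 0<1-u k K (begin-strict
      K * ((1ℚ - u γ + ℕ→ℚ a) * A⁻¹) ^ m        ≡⟨ cong (λ s → K * s ^ m) mean-tilt ⟩
      K * (1ℚ - u γ * A⁻¹) ^ m                  <⟨ *-monoʳ-<-0< (^-pos m 0<1-u/A) K<e ⟩
      expPartial (ℕ→ℚ m * y) N * (1ℚ - u γ * A⁻¹) ^ m ≤⟨ chernoff-lower m N k (subst (ℕ._≤ (Q ℕ.∸ P) ℕ.* m) (ℕ.*-comm _ AQ) (ℕ.m/n*n≤m _ AQ)) ⟩
      (1ℚ - u γ) ^ k                            ∎)
      where
      open ≤-Reasoning
      m = ∣ S ∣
      k = lowerThreshold m
      mean-tilt : (1ℚ - u γ + ℕ→ℚ a) * A⁻¹ ≡ 1ℚ - u γ * A⁻¹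
      mean-tilt = begin-equality
        (1ℚ - u γ + ℕ→ℚ a) * A⁻¹         ≡⟨ solve 3 (λ u k i → (con 1ℚ :- u :+ k) :* i := (con 1ℚ :+ k) :* i :- u :* i) refl (u γ) (ℕ→ℚ a) A⁻¹ ⟩
        (1ℚ + ℕ→ℚ a) * A⁻¹ - u γ * A⁻¹   ≡⟨ cong (λ s → s * A⁻¹ - u γ * A⁻¹) (sym (ℕ→ℚ-suc a)) ⟩
        ℕ→ℚ (suc a) * A⁻¹ - u γ * A⁻¹    ≡⟨ cong (_- u γ * A⁻¹) (ℕ→ℚ*1/suc a) ⟩
        1ℚ - u γ * A⁻¹                   ∎

    Balanced : ∀ {n} → Subset n → Fin (suc a) → (Fin n → Fin (suc a)) → Set
    Balanced S i p = ¬ ((P ℕ.+ Q) ℕ.* ∣ S ∣ ℕ.< AQ ℕ.* ∣ S ∩ block p i ∣) × ¬ (AQ ℕ.* ∣ S ∩ block p i ∣ ℕ.< (Q ℕ.∸ P) ℕ.* ∣ S ∣)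

    tailWeight : ∀ {n} → Subset n → Fin (suc a) → (Fin n → Fin (suc a)) → ℚ
    tailWeight S i p = upperWeight S i p + lowerWeight S i p

    upperWeight-nonNeg : ∀ {n} (S : Subset n) i p → 0ℚ ≤ upperWeight S i p
    upperWeight-nonNeg S i p = markovWeight-nonNeg 0<1+v (upperThreshold ∣ S ∣) ∣ S ∩ block p i ∣

    lowerWeight-nonNeg : ∀ {n} (S : Subset n) i p → 0ℚ ≤ lowerWeight S i p
    lowerWeight-nonNeg S i p = markovWeight-nonNeg 0<1-u (lowerThreshold ∣ S ∣) ∣ S ∩ block p i ∣

    tailWeight-nonNeg : ∀ {n} (S : Subset n) i p → 0ℚ ≤ tailWeight S i p
    tailWeight-nonNeg S i p = 0≤p+q (upperWeight-nonNeg S i p) (lowerWeight-nonNeg S i p)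

    tailWeight<1⇒Balanced : ∀ {n} (S : Subset n) i p → tailWeight S i p < 1ℚ → Balanced S i p
    tailWeight<1⇒Balanced S i p w<1 =
      (λ too-many → <-irrefl refl (<-≤-trans (≤-<-trans (p≤p+q (lowerWeight-nonNeg S i p)) w<1) (1≤upperWeight S i p too-many))) ,
      (λ too-few  → <-irrefl refl (<-≤-trans (≤-<-trans (p≤q+p (upperWeight-nonNeg S i p)) w<1) (1≤lowerWeight S i p too-few)))

    tailWeight-bound : ∀ {K n} (S : Subset n) → K <exp (ℕ→ℚ ∣ S ∣ * y) → ∀ i → K * average a n (tailWeight S i) < ℕ→ℚ 2
    tailWeight-bound {K} {n} S K<e i = subst (_< ℕ→ℚ 2) (cong (K *_) (sym (average-distrib-+ a n (upperWeight S i) (lowerWeight S i))))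
      (subst (_< ℕ→ℚ 2) (sym (*-distribˡ-+ K _ _)) (+-mono-< (upperWeight-bound S K<e i) (lowerWeight-bound S K<e i)))

  -- The random partition

  4*M*x<M*2⇒x+x<1 : ∀ {M x} → 0ℚ < M → ℕ→ℚ 4 * M * x < M * ℕ→ℚ 2 → x + x < 1ℚ
  4*M*x<M*2⇒x+x<1 {M} {x} 0<M 4Mx<2M = *-cancelˡ-<-0≤ (<⇒≤ (0<p*q 0<M (ℕ→ℚ-pos 1))) (begin-strict
    M * ℕ→ℚ 2 * (x + x)    ≡⟨ solve 2 (λ m x → m :* con (ℕ→ℚ 2) :* (x :+ x) := con (ℕ→ℚ 4) :* m :* x) refl M x ⟩
    ℕ→ℚ 4 * M * x          <⟨ 4Mx<2M ⟩
    M * ℕ→ℚ 2              ≡⟨ sym (*-identityʳ (M * ℕ→ℚ 2)) ⟩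
    M * ℕ→ℚ 2 * 1ℚ         ∎)
    where open ≤-Reasoning

  x+x<1⇒y+y<1⇒x+y<1 : ∀ {x y} → x + x < 1ℚ → y + y < 1ℚ → x + y < 1ℚ
  x+x<1⇒y+y<1⇒x+y<1 {x} {y} 2x<1 2y<1 = *-cancelˡ-<-0≤ (<⇒≤ (ℕ→ℚ-pos 1)) (begin-strict
    ℕ→ℚ 2 * (x + y)        ≡⟨ solve 2 (λ x y → con (ℕ→ℚ 2) :* (x :+ y) := (x :+ x) :+ (y :+ y)) refl x y ⟩
    (x + x) + (y + y)      <⟨ +-mono-< 2x<1 2y<1 ⟩
    ℕ→ℚ 2 * 1ℚ             ∎)
    where open ≤-Reasoning

  block-size-bounds : ∀ a b X → ¬ (3 ℕ.* (suc a ℕ.* b) ℕ.< suc a ℕ.* 2 ℕ.* X) → ¬ (suc a ℕ.* 2 ℕ.* X ℕ.< 1 ℕ.* (suc a ℕ.* b)) →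
                      (b ℕ.≤ 2 ℕ.* X) × (2 ℕ.* X ℕ.≤ 3 ℕ.* b)
  block-size-bounds a b X not-too-many not-too-few =
    ℕ.*-cancelˡ-≤ (suc a) (subst₂ ℕ._≤_ (ℕ.*-identityˡ (suc a ℕ.* b)) (ℕ.*-assoc (suc a) 2 X) (ℕ.≮⇒≥ not-too-few)) ,
    ℕ.*-cancelˡ-≤ (suc a) (subst₂ ℕ._≤_ (ℕ.*-assoc (suc a) 2 X) 3[Ab]≡A[3b] (ℕ.≮⇒≥ not-too-many))
    where
    3[Ab]≡A[3b] : 3 ℕ.* (suc a ℕ.* b) ≡ suc a ℕ.* (3 ℕ.* b)
    3[Ab]≡A[3b] = trans (sym (ℕ.*-assoc 3 (suc a) b)) (trans (cong (ℕ._* b) (ℕ.*-comm 3 (suc a))) (ℕ.*-assoc (suc a) 3 b))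

  share-bounds : ∀ {γ} a q P m X → ℕ→ℚ (suc q) * γ ≡ ℕ→ℚ P → P ℕ.≤ suc q →
                 ¬ ((P ℕ.+ suc q) ℕ.* m ℕ.< suc a ℕ.* suc q ℕ.* X) → ¬ (suc a ℕ.* suc q ℕ.* X ℕ.< (suc q ℕ.∸ P) ℕ.* m) →
                 ((1ℚ - γ) * ℕ→ℚ m ≤ ℕ→ℚ (suc a) * ℕ→ℚ X) × (ℕ→ℚ (suc a) * ℕ→ℚ X ≤ (1ℚ + γ) * ℕ→ℚ m)
  share-bounds {γ} a q P m X Qγ≡P P≤Q not-too-many not-too-few =
    *-cancelˡ-≤-0< (ℕ→ℚ-pos q) (begin
      Q * ((1ℚ - γ) * ℕ→ℚ m)           ≡⟨ solve 3 (λ k g m → k :* ((con 1ℚ :- g) :* m) := (k :- k :* g) :* m) refl Q γ (ℕ→ℚ m) ⟩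
      (Q - Q * γ) * ℕ→ℚ m              ≡⟨ cong (λ p → (Q - p) * ℕ→ℚ m) Qγ≡P ⟩
      (Q - ℕ→ℚ P) * ℕ→ℚ m              ≡⟨ cong (_* ℕ→ℚ m) (sym (ℕ→ℚ-homo-∸ P≤Q)) ⟩
      ℕ→ℚ (suc q ℕ.∸ P) * ℕ→ℚ m        ≡⟨ sym (ℕ→ℚ-homo-* (suc q ℕ.∸ P) m) ⟩
      ℕ→ℚ ((suc q ℕ.∸ P) ℕ.* m)        ≤⟨ ℕ→ℚ-mono-≤ (ℕ.≮⇒≥ not-too-few) ⟩
      ℕ→ℚ (suc a ℕ.* suc q ℕ.* X)      ≡⟨ AQX ⟩
      Q * (ℕ→ℚ (suc a) * ℕ→ℚ X)        ∎) ,
    *-cancelˡ-≤-0< (ℕ→ℚ-pos q) (begin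
      Q * (ℕ→ℚ (suc a) * ℕ→ℚ X)        ≡⟨ sym AQX ⟩
      ℕ→ℚ (suc a ℕ.* suc q ℕ.* X)      ≤⟨ ℕ→ℚ-mono-≤ (ℕ.≮⇒≥ not-too-many) ⟩
      ℕ→ℚ ((P ℕ.+ suc q) ℕ.* m)        ≡⟨ ℕ→ℚ-homo-* (P ℕ.+ suc q) m ⟩
      ℕ→ℚ (P ℕ.+ suc q) * ℕ→ℚ m        ≡⟨ cong (_* ℕ→ℚ m) (ℕ→ℚ-homo-+ P (suc q)) ⟩
      (ℕ→ℚ P + Q) * ℕ→ℚ m              ≡⟨ cong (λ p → (p + Q) * ℕ→ℚ m) (sym Qγ≡P) ⟩
      (Q * γ + Q) * ℕ→ℚ m              ≡⟨ solve 3 (λ k g m → (k :* g :+ k) :* m := k :* ((con 1ℚ :+ g) :* m)) refl Q γ (ℕ→ℚ m) ⟩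
      Q * ((1ℚ + γ) * ℕ→ℚ m)           ∎)
    where
    open ≤-Reasoning
    Q = ℕ→ℚ (suc q)
    AQX : ℕ→ℚ (suc a ℕ.* suc q ℕ.* X) ≡ Q * (ℕ→ℚ (suc a) * ℕ→ℚ X)
    AQX = begin-equality
      ℕ→ℚ (suc a ℕ.* suc q ℕ.* X)          ≡⟨ ℕ→ℚ-homo-* (suc a ℕ.* suc q) X ⟩
      ℕ→ℚ (suc a ℕ.* suc q) * ℕ→ℚ X        ≡⟨ cong (_* ℕ→ℚ X) (ℕ→ℚ-homo-* (suc a) (suc q)) ⟩
      ℕ→ℚ (suc a) * Q * ℕ→ℚ X              ≡⟨ solve 3 (λ a k x → a :* k :* x := k :* (a :* x)) refl (ℕ→ℚ (suc a)) Q (ℕ→ℚ X) ⟩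
      Q * (ℕ→ℚ (suc a) * ℕ→ℚ X)            ∎

  -- The part sizes are the case S = U, γ = 1/2 (P = 1, Q = 2) of the share bounds.
  module BalancedPartition {γ : ℚ} (0≤γ : 0ℚ ≤ γ) (γ≤1 : γ ≤ 1ℚ) (a b f q P : ℕ)
    (Qγ≡P : ℕ→ℚ (suc q) * γ ≡ ℕ→ℚ P) (P≤Q : P ℕ.≤ suc q)
    (Kˢ<exp : ℕ→ℚ (4 ℕ.* suc a) <exp (ℕ→ℚ (suc a ℕ.* b) * (z ½ * 1/suc a)))
    (ℱ : Fin (suc f) → Subset (suc a ℕ.* b))
    (Kᶠ<exp : ∀ F → ℕ→ℚ (4 ℕ.* suc a ℕ.* suc f) <exp (ℕ→ℚ ∣ ℱ F ∣ * (z γ * 1/suc a))) where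

    n : ℕ
    n = suc a ℕ.* b

    module Sizes  = TailWeights 0≤½ ½≤1 a 1 1 refl (s≤s z≤n)
    module Shares = TailWeights 0≤γ γ≤1 a q P Qγ≡P P≤Q

    sizeBadness shareBadness badness : (Fin n → Fin (suc a)) → ℚ
    sizeBadness p  = ∑[ i < suc a ] Sizes.tailWeight ⊤ i p
    shareBadness p = ∑[ F < suc f ] ∑[ i < suc a ] Shares.tailWeight (ℱ F) i p
    badness p      = sizeBadness p + shareBadness p

    sizeBadness-small : average a n sizeBadness + average a n sizeBadness < 1ℚ
    sizeBadness-small = 4*M*x<M*2⇒x+x<1 {x = average a n sizeBadness} (ℕ→ℚ-pos a) (begin-strict
      ℕ→ℚ 4 * ℕ→ℚ (suc a) * average a n sizeBadness
        ≡⟨ cong₂ _*_ (sym (ℕ→ℚ-homo-* 4 (suc a))) (average-sum a n (suc a) (λ i → Sizes.tailWeight ⊤ i)) ⟩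
      ℕ→ℚ (4 ℕ.* suc a) * ∑[ i < suc a ] average a n (Sizes.tailWeight ⊤ i)
        <⟨ *-sum-< (ℕ→ℚ (4 ℕ.* suc a)) (ℕ→ℚ 2) (λ i → average a n (Sizes.tailWeight (⊤ {n}) i))
             (Sizes.tailWeight-bound (⊤ {n}) (subst (λ m → ℕ→ℚ (4 ℕ.* suc a) <exp (ℕ→ℚ m * (z ½ * 1/suc a))) (sym (∣⊤∣≡n n)) Kˢ<exp)) ⟩
      ℕ→ℚ (suc a) * ℕ→ℚ 2 ∎)
      where open ≤-Reasoning

    shareBadness-small : average a n shareBadness + average a n shareBadness < 1ℚ
    shareBadness-small = 4*M*x<M*2⇒x+x<1 {x = average a n shareBadness} (0<p*q (ℕ→ℚ-pos a) (ℕ→ℚ-pos f)) (begin-strict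
      ℕ→ℚ 4 * (A * F) * average a n shareBadness
        ≡⟨ cong₂ _*_ (solve 3 (λ k a f → k :* (a :* f) := k :* a :* f) refl (ℕ→ℚ 4) A F)
                     (average-sum a n (suc f) (λ G p → ∑[ i < suc a ] Shares.tailWeight (ℱ G) i p)) ⟩
      ℕ→ℚ 4 * A * F * ∑[ G < suc f ] average a n (λ p → ∑[ i < suc a ] Shares.tailWeight (ℱ G) i p)
        ≡⟨ cong₂ _*_ (sym (trans (ℕ→ℚ-homo-* (4 ℕ.* suc a) (suc f)) (cong (_* F) (ℕ→ℚ-homo-* 4 (suc a)))))
                     (sum-cong-≗ (λ G → average-sum a n (suc a) (Shares.tailWeight (ℱ G)))) ⟩
      Kᶠ * ∑[ G < suc f ] ∑[ i < suc a ] average a n (Shares.tailWeight (ℱ G) i)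
        <⟨ *-sum-< Kᶠ (A * ℕ→ℚ 2) (λ G → ∑[ i < suc a ] average a n (Shares.tailWeight (ℱ G) i))
             (λ G → *-sum-< Kᶠ (ℕ→ℚ 2) (λ i → average a n (Shares.tailWeight (ℱ G) i)) (Shares.tailWeight-bound (ℱ G) (Kᶠ<exp G))) ⟩
      F * (A * ℕ→ℚ 2)
        ≡⟨ solve 3 (λ f a t → f :* (a :* t) := a :* f :* t) refl F A (ℕ→ℚ 2) ⟩
      A * F * ℕ→ℚ 2 ∎)
      where
      open ≤-Reasoning
      A = ℕ→ℚ (suc a)
      F = ℕ→ℚ (suc f)
      Kᶠ = ℕ→ℚ (4 ℕ.* suc a ℕ.* suc f)

    good-partition : Σ (Fin n → Fin (suc a)) λ p → badness p < 1ℚ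
    good-partition = average<⇒∃< a n badness 1ℚ
      (subst (_< 1ℚ) (sym (average-distrib-+ a n sizeBadness shareBadness))
        (x+x<1⇒y+y<1⇒x+y<1 {average a n sizeBadness} {average a n shareBadness} sizeBadness-small shareBadness-small))

    p : Fin n → Fin (suc a)
    p = proj₁ good-partition

    sizes : ∀ i → (b ℕ.≤ 2 ℕ.* ∣ block p i ∣) × (2 ℕ.* ∣ block p i ∣ ℕ.≤ 3 ℕ.* b)
    sizes i = uncurry (block-size-bounds a b ∣ block p i ∣)
      (subst₂ (λ m x → ¬ (3 ℕ.* m ℕ.< suc a ℕ.* 2 ℕ.* x) × ¬ (suc a ℕ.* 2 ℕ.* x ℕ.< 1 ℕ.* m))
              (∣⊤∣≡n n) (cong ∣_∣ (∩-identityˡ (block p i)))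
              (Sizes.tailWeight<1⇒Balanced (⊤ {n}) i p (≤-<-trans
                (term≤sum (λ i → Sizes.tailWeight-nonNeg (⊤ {n}) i p) i)
                (≤-<-trans (p≤p+q (sum-nonNeg (λ G → sum-nonNeg (λ j → Shares.tailWeight-nonNeg (ℱ G) j p))))
                           (proj₂ good-partition)))))

    shares : ∀ F i → ((1ℚ - γ) * ℕ→ℚ ∣ ℱ F ∣ ≤ ℕ→ℚ (suc a) * ℕ→ℚ ∣ ℱ F ∩ block p i ∣) ×
                     (ℕ→ℚ (suc a) * ℕ→ℚ ∣ ℱ F ∩ block p i ∣ ≤ (1ℚ + γ) * ℕ→ℚ ∣ ℱ F ∣)
    shares F i = uncurry (share-bounds a q P ∣ ℱ F ∣ ∣ ℱ F ∩ block p i ∣ Qγ≡P P≤Q)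
      (Shares.tailWeight<1⇒Balanced (ℱ F) i p (≤-<-trans
        (term≤sum (λ j → Shares.tailWeight-nonNeg (ℱ F) j p) i)
        (≤-<-trans (term≤sum (λ G → sum-nonNeg (λ j → Shares.tailWeight-nonNeg (ℱ G) j p)) F)
          (≤-<-trans (p≤q+p (sum-nonNeg (λ j → Sizes.tailWeight-nonNeg (⊤ {n}) j p))) (proj₂ good-partition)))))

  balanced-partition : ∀ {γ} a b f q P → 0ℚ ≤ γ → γ ≤ 1ℚ → ℕ→ℚ (suc q) * γ ≡ ℕ→ℚ P → P ℕ.≤ suc q →
    ℕ→ℚ (4 ℕ.* suc a) <exp (ℕ→ℚ (suc a ℕ.* b) * (z ½ * 1/suc a)) →
    (ℱ : Fin (suc f) → Subset (suc a ℕ.* b)) →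
    (∀ F → ℕ→ℚ (4 ℕ.* suc a ℕ.* suc f) <exp (ℕ→ℚ ∣ ℱ F ∣ * (z γ * 1/suc a))) →
    Σ (Fin (suc a ℕ.* b) → Fin (suc a)) λ p →
      (∀ i → (b ℕ.≤ 2 ℕ.* ∣ block p i ∣) × (2 ℕ.* ∣ block p i ∣ ℕ.≤ 3 ℕ.* b)) ×
      (∀ F i → ((1ℚ - γ) * ℕ→ℚ ∣ ℱ F ∣ ≤ ℕ→ℚ (suc a) * ℕ→ℚ ∣ ℱ F ∩ block p i ∣) ×
               (ℕ→ℚ (suc a) * ℕ→ℚ ∣ ℱ F ∩ block p i ∣ ≤ (1ℚ + γ) * ℕ→ℚ ∣ ℱ F ∣))
  balanced-partition a b f q P 0≤γ γ≤1 Qγ≡P P≤Q Kˢ<exp ℱ Kᶠ<exp = p , sizes , shares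
    where open BalancedPartition 0≤γ γ≤1 a b f q P Qγ≡P P≤Q Kˢ<exp ℱ Kᶠ<exp

  size-exponent : ∀ a b → ℤ.+ b / 12 ≡ ℕ→ℚ (suc a ℕ.* b) * (z ½ * 1/suc a)
  size-exponent a b = begin
    ℤ.+ b / 12                                   ≡⟨ +n/[1+d]≡n*1/suc b 11 ⟩
    ℕ→ℚ b * z ½                                  ≡⟨ sym (*-identityʳ (ℕ→ℚ b * z ½)) ⟩
    ℕ→ℚ b * z ½ * 1ℚ                             ≡⟨ cong (ℕ→ℚ b * z ½ *_) (sym (ℕ→ℚ*1/suc a)) ⟩
    ℕ→ℚ b * z ½ * (ℕ→ℚ (suc a) * 1/suc a)        ≡⟨ solve 4 (λ b z k r → b :* z :* (k :* r) := (k :* b) :* (z :* r)) refl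
                                                        (ℕ→ℚ b) (z ½) (ℕ→ℚ (suc a)) (1/suc a) ⟩
    (ℕ→ℚ (suc a) * ℕ→ℚ b) * (z ½ * 1/suc a)      ≡⟨ cong (_* (z ½ * 1/suc a)) (sym (ℕ→ℚ-homo-* (suc a) b)) ⟩
    ℕ→ℚ (suc a ℕ.* b) * (z ½ * 1/suc a)          ∎
    where open ≡-Reasoning

  size-hypothesis : ∀ {K} a b → K <exp (ℤ.+ b / 12) → K <exp (ℕ→ℚ (suc a ℕ.* b) * (z ½ * 1/suc a))
  size-hypothesis {K} a b = subst (K <exp_) (size-exponent a b)

  share-hypothesis : ∀ {γ K} a c m → 0ℚ ≤ γ → γ ≤ 1ℚ → c ℕ.≤ m →
                     K <exp ((ℤ.+ c / 3 * 1/suc a) * (γ * γ)) → K <exp (ℕ→ℚ m * (z γ * 1/suc a))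
  share-hypothesis {γ} {K} a c m 0≤γ γ≤1 c≤m K<e =
    <exp-mono (subst (K <exp_) share-exponent K<e) (0≤p*q (ℕ→ℚ-nonNeg c) 0≤z/A) (*-monoʳ-≤-0≤ 0≤z/A (ℕ→ℚ-mono-≤ c≤m))
    where
    0≤z/A = 0≤p*q (ParameterBounds.0≤z 0≤γ γ≤1) (1/suc-nonNeg a)
    share-exponent : (ℤ.+ c / 3 * 1/suc a) * (γ * γ) ≡ ℕ→ℚ c * (z γ * 1/suc a)
    share-exponent = trans (cong (λ x → x * 1/suc a * (γ * γ)) (+n/[1+d]≡n*1/suc c 2))
                           (solve 4 (λ c t r g → c :* t :* r :* (g :* g) := c :* (g :* g :* t :* r)) refl (ℕ→ℚ c) ⅓ (1/suc a) γ)

  mkℚ<1⇒n≤1+d : ∀ n d .(c : Coprime n (suc d)) → mkℚ (ℤ.+ n) d c < 1ℚ → n ℕ.≤ suc d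
  mkℚ<1⇒n≤1+d n d c γ<1 = ℕ→ℚ-cancel-≤ (subst₂ _≤_ ([1+d]*mkℚ≡n n d c) (*-identityʳ (ℕ→ℚ (suc d)))
                                          (*-monoˡ-≤-0≤ (ℕ→ℚ-nonNeg (suc d)) (<⇒≤ γ<1)))

  0≮mkℚ-[1+n] : ∀ n d .(c : Coprime (suc n) (suc d)) → ¬ (0ℚ < mkℚ ℤ.-[1+ n ] d c)
  0≮mkℚ-[1+n] n d c 0<γ = <-asym 0<γ (negative⁻¹ _)

open import Data.Nat using (ℕ; _≤_; _*_; NonZero)
open import Data.Rational using (ℚ; 0ℚ; 1ℚ; _<_; _-_) renaming (_≤_ to _≤ℚ_; _*_ to _*ℚ_; _+_ to _+ℚ_; _/_ to _/ℚ_)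
open import Data.Integer using (+_)
open import Data.Fin using (Fin)
open import Data.Fin.Subset using (Subset; ∣_∣; _∩_)
open import Function.Definitions using (Injective)
open import Relation.Binary.PropositionalEquality using (_≡_)
open import Data.Product using (Σ; _×_)

open import Data.Nat using (zero; suc)
open import Data.Integer using (-[1+_])
open import Data.Rational using (mkℚ)
open import Data.Rational.Properties using (<⇒≤)
open import Data.Empty.Irrelevant using (⊥-elim)
open RandomPartition
  using (balanced-partition; size-hypothesis; share-hypothesis; [1+d]*mkℚ≡n; mkℚ<1⇒n≤1+d; 0≮mkℚ-[1+n])

lemma7p10 : (a b c f : ℕ) → .{{_ : NonZero a}} → 1 ≤ b → 1 ≤ c → 1 ≤ f →
    LnLt (ℕ→ℚ (4 * a)) ((+ b) /ℚ 12) →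
    (γ : ℚ) → 0ℚ < γ → γ < 1ℚ →
    LnLt (ℕ→ℚ (4 * a * f)) ((((+ c) /ℚ 3) *ℚ ((+ 1) /ℚ a)) *ℚ (γ *ℚ γ)) →
    (ℱ : Fin f → Subset (a * b)) → Injective _≡_ _≡_ ℱ →
    (∀ F → c ≤ ∣ ℱ F ∣) →
    Σ (Fin (a * b) → Fin a) λ p →
      (∀ i → (b ≤ 2 * ∣ block p i ∣) × (2 * ∣ block p i ∣ ≤ 3 * b)) ×
      (∀ F i →
        ((1ℚ - γ) *ℚ ℕ→ℚ ∣ ℱ F ∣ ≤ℚ ℕ→ℚ a *ℚ ℕ→ℚ ∣ ℱ F ∩ block p i ∣) ×
        (ℕ→ℚ a *ℚ ℕ→ℚ ∣ ℱ F ∩ block p i ∣ ≤ℚ (1ℚ +ℚ γ) *ℚ ℕ→ℚ ∣ ℱ F ∣))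
lemma7p10 zero b c f {{a≢0}} _ _ _ _ _ _ _ _ _ _ _ = ⊥-elim (NonZero.nonZero a≢0)
lemma7p10 (suc a) b c zero _ _ () _ _ _ _ _ _ _ _
lemma7p10 (suc a) b c (suc f) _ _ _ size-bound (mkℚ (+ P) d coprime) 0<γ γ<1 share-bound ℱ _ c≤∣ℱ∣ =
  balanced-partition a b f d P (<⇒≤ 0<γ) (<⇒≤ γ<1) ([1+d]*mkℚ≡n P d coprime) (mkℚ<1⇒n≤1+d P d coprime γ<1)
    (size-hypothesis a b size-bound) ℱ
    (λ F → share-hypothesis a c ∣ ℱ F ∣ (<⇒≤ 0<γ) (<⇒≤ γ<1) (c≤∣ℱ∣ F) share-bound)
lemma7p10 (suc a) b c (suc f) _ _ _ _ (mkℚ -[1+ k ] d coprime) 0<γ _ _ _ _ _ = ⊥-elim (0≮mkℚ-[1+n] k d coprime 0<γ)
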